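{- Let $\mathcal L$ be a finite family of straight lines in the plane in general position, and let $\mathcal P$ be a finite family of points such that each line in $\mathcal L$ contains precisely $k\geq 3$ points of $\mathcal P$. Assume each $p\in\mathcal P$ has a list of at least $R$ colors. If $$R \geq 1+\left\lfloor \frac{k-1}{k-2} \sqrt[k-1]{4k^2-8k}\right\rfloor,$$ then for each $p\in\mathcal P$ one can choose a color from its list so that no two lines of $\mathcal L$ sharing a common point of $\mathcal P$ have the same sequence of colors, regardless of the direction in which each of the two lines is traversed.
   Context: A family of lines is in general position if no three of the lines share a common point. The sequence of colors of a line, traversed in a given direction, is the sequence of colors of its $k$ points of $\mathcal P$ in the order they appear along the line in that direction. -}

module Defs where

open import Data.Nat as ℕ using (ℕ; zero; suc)
open import Data.Fin using (Fin; toℕ)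
open import Data.Product using (Σ; ∃; _×_; _,_)
open import Data.Sum using (_⊎_)
open import Data.List using (List; length)
open import Data.List.Membership.Propositional using (_∈_)
open import Data.List.Relation.Unary.Unique.Propositional using (Unique)
open import Relation.Binary.PropositionalEquality using (_≡_; _≢_)
open import Relation.Nullary using (¬_)
open import Data.Empty using (⊥)

-- The real numbers, axiomatised as a complete ordered field.
-- The theorem is stated for every model of these axioms (i.e. for ℝ).

record RealField : Set₁ where
  field
    Carrier : Set
    0# 1#   : Carrier
    _+_ _*_ : Carrier → Carrier → Carrier
    -_      : Carrier → Carrier
    _<_     : Carrier → Carrier → Set
    +-assoc  : ∀ x y z → (x + y) + z ≡ x + (y + z)
    +-comm   : ∀ x y → x + y ≡ y + x
    +-idˡ    : ∀ x → 0# + x ≡ x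
    +-invˡ   : ∀ x → (- x) + x ≡ 0#
    *-assoc  : ∀ x y z → (x * y) * z ≡ x * (y * z)
    *-comm   : ∀ x y → x * y ≡ y * x
    *-idˡ    : ∀ x → 1# * x ≡ x
    distribˡ : ∀ x y z → x * (y + z) ≡ (x * y) + (x * z)
    0≢1      : 0# ≢ 1#
    *-inv    : ∀ x → x ≢ 0# → ∃ λ y → x * y ≡ 1#
    <-irrefl : ∀ x → ¬ (x < x)
    <-trans  : ∀ x y z → x < y → y < z → x < z
    <-tri    : ∀ x y → (x < y) ⊎ ((x ≡ y) ⊎ (y < x))
    +-mono-< : ∀ x y z → x < y → (x + z) < (y + z)
    *-pos    : ∀ x y → 0# < x → 0# < y → 0# < (x * y)

  _≤_ : Carrier → Carrier → Set
  x ≤ y = (x < y) ⊎ (x ≡ y)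

  field
    complete : (S : Carrier → Set) → (∃ λ x → S x) →
               (∃ λ b → ∀ x → S x → x ≤ b) →
               ∃ λ s → (∀ x → S x → x ≤ s) ×
                       (∀ b → (∀ x → S x → x ≤ b) → s ≤ b)

module Plane (ℝ : RealField) where
  open RealField ℝ

  _-_ : Carrier → Carrier → Carrier
  x - y = x + (- y)

  Point : Set
  Point = Carrier × Carrier

  record Line : Set where
    constructor line
    field
      a b c    : Carrier
      nondegen : ¬ ((a ≡ 0#) × (b ≡ 0#))

  _on_ : Point → Line → Set
  (x , y) on line a b c _ = ((a * x) + (b * y)) + c ≡ 0#

  SameLine : Line → Line → Set
  SameLine L M = ∀ p → ((p on L → p on M) × (p on M → p on L))

  Between : Point → Point → Point → Set
  Between (px , py) (qx , qy) (rx , ry) =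
    ∃ λ t → (0# < t) × (t < 1#) ×
            (qx ≡ px + (t * (rx - px))) × (qy ≡ py + (t * (ry - py)))

  DistinctLines : {m : ℕ} → (Fin m → Line) → Set
  DistinctLines {m} L = ∀ (i j : Fin m) → i ≢ j → ¬ SameLine (L i) (L j)

  GeneralPosition : {m : ℕ} → (Fin m → Line) → Set
  GeneralPosition {m} L = ∀ (i j l : Fin m) → i ≢ j → j ≢ l → i ≢ l →
    ∀ p → ¬ ((p on L i) × (p on L j) × (p on L l))

  DistinctPoints : {n : ℕ} → (Fin n → Point) → Set
  DistinctPoints {n} P = ∀ (s t : Fin n) → P s ≡ P t → s ≡ t

  ContainsExactly : {n : ℕ} → (Fin n → Point) → Line → ℕ → Set
  ContainsExactly {n} P L k =
    ∃ λ (f : Fin k → Fin n) →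
      (∀ a b → f a ≡ f b → a ≡ b) ×
      (∀ a → P (f a) on L) ×
      (∀ t → P t on L → ∃ λ a → f a ≡ t)

  -- e lists the k points of P on L in the order in which they appear
  -- along L (in one of the two directions)
  AlongLine : {n k : ℕ} → (Fin n → Point) → Line → (Fin k → Fin n) → Set
  AlongLine {n} {k} P L e =
    (∀ a b → e a ≡ e b → a ≡ b) ×
    (∀ a → P (e a) on L) ×
    (∀ t → P t on L → ∃ λ a → e a ≡ t) ×
    (∀ (a b c : Fin k) → toℕ a ℕ.< toℕ b → toℕ b ℕ.< toℕ c →
       Between (P (e a)) (P (e b)) (P (e c)))

-- The numerical condition  R ≥ 1 + ⌊ (k-1)/(k-2) · (4k²-8k)^{1/(k-1)} ⌋,
-- which (for k ≥ 3, R ∈ ℕ) is equivalent to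
--   (k-1)/(k-2) · (4k²-8k)^{1/(k-1)} < R,  i.e.
--   (k-1)^{k-1} · (4k²-8k) < R^{k-1} · (k-2)^{k-1}.

BoundHolds : ℕ → ℕ → Set
BoundHolds k R =
  ((k ℕ.∸ 1) ℕ.^ (k ℕ.∸ 1)) ℕ.* ((4 ℕ.* k ℕ.* k) ℕ.∸ (8 ℕ.* k))
    ℕ.< (R ℕ.^ (k ℕ.∸ 1)) ℕ.* ((k ℕ.∸ 2) ℕ.^ (k ℕ.∸ 1))

module Submission where

open import Defs
open import Data.Nat using (ℕ; _≤_)
open import Data.Fin using (Fin)
open import Data.Product using (∃; _×_)
open import Data.List using (List; length)
open import Data.List.Membership.Propositional using (_∈_)
open import Data.List.Relation.Unary.Unique.Propositional using (Unique)
open import Relation.Binary.PropositionalEquality using (_≡_; _≢_)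
open import Relation.Nullary using (¬_)
open import Data.Nat using (suc; s≤s; z≤n)
open import Data.Fin.Subset.Properties using (∈⊤)
open import Data.Product using (_,_; proj₁; proj₂)
open import Data.Sum using (inj₂)
open import Data.Vec using (lookup)

-- Rosenfeld's counting argument.  Call a colouring of a point set S good if it takes every point of S
-- to a colour from its list and no two distinct intersecting lines, each read along its order, show the
-- same sequence of colours on points of S.  With κ = k − 1 and β = R (k − 2), induction on |S| gives
-- β · #good (S − v) ≤ κ · #good S for v ∈ S.  Among the at least R · #good (S − v) extensions of good
-- colourings of S − v to v, a bad one has a repetition through v, described by a line ℓ through v (at
-- most two choices), a line meeting ℓ (at most k) and a relative direction (two).  For a fixed
-- description the colours of the k − 2 points of ℓ other than v and the crossing are copied from the
-- other line, so those extensions inject into the good colourings of a set with k − 2 further points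
-- removed, which the induction hypothesis bounds by (κ / β)^(k − 2) · #good (S − v).  The hypothesis on
-- R absorbs the 4k error terms, and starting from the empty set gives a good colouring of all points.
-- On the geometric side each line is ordered by one coordinate, so its enumerations along the line are
-- unique up to reversal; two lines share at most one point, and no three are concurrent.

module ListCounting where

  open import Data.Nat using (ℕ; suc; _+_; _*_; _≤_; _<_; z≤n; s≤s)
  open import Data.Nat.Properties
  open import Data.Nat.ListAction using (sum)
  open import Data.Product using (∃; _,_)
  open import Data.Empty using (⊥; ⊥-elim)
  open import Data.List using (List; []; _∷_; length; filter; map; concatMap; cartesianProduct)
  open import Data.List.Properties using (length-++; length-map; length-removeAt′)
  open import Data.List.Membership.Propositional using (_∈_; _─_)
  open import Data.List.Relation.Unary.Any using (here; there; index)
  open import Data.List.Relation.Unary.All as All using (_∷_)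
  open import Data.List.Relation.Unary.AllPairs using (_∷_)
  open import Data.List.Relation.Unary.Unique.Propositional using (Unique)
  open import Relation.Binary.PropositionalEquality
  open import Relation.Nullary using (yes; no)
  open import Relation.Nullary.Decidable using (¬?)
  open import Relation.Unary using (Pred; Decidable)
  open import Function using (_∘_)
  open import Level using (0ℓ)

  private variable
    A B : Set

  ∈-─⁺ : ∀ {xs : List A} {x y} → x ∈ xs → (y∈xs : y ∈ xs) → x ≢ y → x ∈ xs ─ y∈xs
  ∈-─⁺ (here refl) (here refl)  x≢y = ⊥-elim (x≢y refl)
  ∈-─⁺ (there x∈)  (here refl)  x≢y = x∈
  ∈-─⁺ (here refl) (there y∈)   x≢y = here refl
  ∈-─⁺ (there x∈)  (there y∈)   x≢y = there (∈-─⁺ x∈ y∈ x≢y)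

  length-≤-injection : ∀ (f : A → B) {xs : List A} {ys : List B} → Unique xs →
    (∀ {x} → x ∈ xs → f x ∈ ys) →
    (∀ {x y} → x ∈ xs → y ∈ xs → f x ≡ f y → x ≡ y) →
    length xs ≤ length ys
  length-≤-injection f {[]}     _            _    _   = z≤n
  length-≤-injection f {x ∷ xs} {ys} (x∉xs ∷ uniq) into inj =
    subst (suc (length xs) ≤_) (sym (length-removeAt′ ys (index fx∈ys)))
      (s≤s (length-≤-injection f uniq into′ (λ p q → inj (there p) (there q))))
    where
    fx∈ys : f x ∈ ys
    fx∈ys = into (here refl)
    into′ : ∀ {y} → y ∈ xs → f y ∈ ys ─ fx∈ys
    into′ y∈xs = ∈-─⁺ (into (there y∈xs)) fx∈ys
      (λ fy≡fx → All.lookup x∉xs y∈xs (sym (inj (there y∈xs) (here refl) fy≡fx)))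

  length-partition : ∀ {P : Pred A 0ℓ} (P? : Decidable P) xs →
    length xs ≡ length (filter P? xs) + length (filter (¬? ∘ P?) xs)
  length-partition P? []       = refl
  length-partition P? (x ∷ xs) with P? x
  ... | yes _ = cong suc (length-partition P? xs)
  ... | no  _ = trans (cong suc (length-partition P? xs)) (sym (+-suc _ _))

  length-concatMap : ∀ (f : A → List B) xs → length (concatMap f xs) ≡ sum (map (length ∘ f) xs)
  length-concatMap f []       = refl
  length-concatMap f (x ∷ xs) = trans (length-++ (f x)) (cong (length (f x) +_) (length-concatMap f xs))

  length-cartesianProduct : ∀ (xs : List A) (ys : List B) → length (cartesianProduct xs ys) ≡ length xs * length ys
  length-cartesianProduct []       ys = refl
  length-cartesianProduct (x ∷ xs) ys = trans (length-++ (map (x ,_) ys))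
    (cong₂ _+_ (length-map (x ,_) ys) (length-cartesianProduct xs ys))

  *-sum-≤ : ∀ c M (f : A → ℕ) xs → (∀ {x} → x ∈ xs → c * f x ≤ M) → c * sum (map f xs) ≤ length xs * M
  *-sum-≤ c M f []       _     = ≤-reflexive (*-zeroʳ c)
  *-sum-≤ c M f (x ∷ xs) bound = begin
    c * (f x + sum (map f xs))     ≡⟨ *-distribˡ-+ c (f x) _ ⟩
    c * f x + c * sum (map f xs)   ≤⟨ +-mono-≤ (bound (here refl)) (*-sum-≤ c M f xs (bound ∘ there)) ⟩
    M + length xs * M              ∎
    where open ≤-Reasoning

  sum-map-≤ : ∀ M (f : A → ℕ) xs → (∀ {x} → x ∈ xs → f x ≤ M) → sum (map f xs) ≤ length xs * M
  sum-map-≤ M f []       _     = z≤n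
  sum-map-≤ M f (x ∷ xs) bound = +-mono-≤ (bound (here refl)) (sum-map-≤ M f xs (bound ∘ there))

  length-≤2 : ∀ {xs : List A} → Unique xs →
    (∀ {a b c} → a ∈ xs → b ∈ xs → c ∈ xs → a ≢ b → b ≢ c → a ≢ c → ⊥) → length xs ≤ 2
  length-≤2 {xs = []}                 _ _ = z≤n
  length-≤2 {xs = _ ∷ []}             _ _ = s≤s z≤n
  length-≤2 {xs = _ ∷ _ ∷ []}         _ _ = s≤s (s≤s z≤n)
  length-≤2 {xs = _ ∷ _ ∷ _ ∷ _} ((a≢b ∷ a≢c ∷ _) ∷ (b≢c ∷ _) ∷ _) no-three =
    ⊥-elim (no-three (here refl) (there (here refl)) (there (there (here refl))) a≢b b≢c a≢c)

  ∈⇒length>0 : ∀ {x : A} {xs} → x ∈ xs → 0 < length xs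
  ∈⇒length>0 (here _)  = s≤s z≤n
  ∈⇒length>0 (there _) = s≤s z≤n

  length>0⇒∈ : ∀ {xs : List A} → 0 < length xs → ∃ λ x → x ∈ xs
  length>0⇒∈ {xs = x ∷ _} _ = x , here refl

module FinLemmas where

  open import Data.Nat as ℕ using (zero; suc)
  import Data.Nat.Properties as ℕ
  open import Data.Fin as F using (Fin; _<_)
  import Data.Fin.Properties as Fin
  open import Data.Product using (Σ; _,_)
  open import Data.Bool using (Bool; true; false)
  open import Data.Vec using (Vec; []; _∷_)
  open import Relation.Binary.PropositionalEquality
  open import Relation.Nullary using (Dec; yes; no)
  open import Function using (_∘_)

  opposite-injective : ∀ {k} {a b : Fin k} → F.opposite a ≡ F.opposite b → a ≡ b
  opposite-injective {a = a} {b} eq =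
    trans (sym (Fin.opposite-involutive a)) (trans (cong F.opposite eq) (Fin.opposite-involutive b))

  opposite-reverses-< : ∀ {k} {a b : Fin k} → a < b → F.opposite b < F.opposite a
  opposite-reverses-< {k} {a} {b} a<b = subst₂ ℕ._<_ (sym (Fin.opposite-prop b)) (sym (Fin.opposite-prop a))
    (ℕ.∸-monoʳ-< (ℕ.s≤s a<b) (Fin.toℕ<n b))

  oriented : ∀ {A : Set} {k} → Bool → (Fin k → A) → Fin k → A
  oriented true  f = f
  oriented false f = f ∘ F.opposite

  oriented-injective : ∀ {A : Set} {k} d {f : Fin k → A} → (∀ {a b} → f a ≡ f b → a ≡ b) →
    ∀ {a b} → oriented d f a ≡ oriented d f b → a ≡ b
  oriented-injective true  inj eq = inj eq
  oriented-injective false inj eq = opposite-injective (inj eq)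

  oriented-on : ∀ {A : Set} {k} d {P : A → Set} {f : Fin k → A} → (∀ a → P (f a)) → ∀ a → P (oriented d f a)
  oriented-on true  on a = on a
  oriented-on false on a = on (F.opposite a)

  oriented-cong : ∀ {A : Set} {k} d {f g : Fin k → A} → (∀ a → f a ≡ g a) → ∀ a → oriented d f a ≡ oriented d g a
  oriented-cong true  f≗g a = f≗g a
  oriented-cong false f≗g a = f≗g (F.opposite a)

  oriented-swap-∀ : ∀ {A : Set} {k} d {P : A → A → Set} {f g : Fin k → A} →
    (∀ x → P (f x) (oriented d g x)) → ∀ x → P (oriented d f x) (g x)
  oriented-swap-∀ true  h x = h x
  oriented-swap-∀ false {P} {f} {g} h x =
    subst (P (f (F.opposite x))) (cong g (Fin.opposite-involutive x)) (h (F.opposite x))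

  oriented-swap-∃ : ∀ {A : Set} {k} d {P : A → A → Set} {f g : Fin k → A} →
    (Σ (Fin k) λ x → P (f x) (oriented d g x)) → Σ (Fin k) λ x → P (oriented d f x) (g x)
  oriented-swap-∃ true  h = h
  oriented-swap-∃ false {P} {f} {g} (x , p) =
    F.opposite x , subst (λ a → P (f a) (g (F.opposite x))) (sym (Fin.opposite-involutive x)) p

  any-vec? : ∀ {n} r {P : Vec (Fin n) r → Set} → (∀ u → Dec (P u)) → Dec (Σ (Vec (Fin n) r) P)
  any-vec? zero    P? with P? []
  ... | yes p = yes ([] , p)
  ... | no ¬p = no λ { ([] , p) → ¬p p }
  any-vec? (suc r) P? with Fin.any? (λ a → any-vec? r (λ u → P? (a ∷ u)))
  ... | yes (a , u , p) = yes (a ∷ u , p)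
  ... | no ¬p           = no λ { (a ∷ u , p) → ¬p (a , u , p) }

  any-bool? : ∀ {P : Bool → Set} → (∀ d → Dec (P d)) → Dec (Σ Bool P)
  any-bool? P? with P? true | P? false
  ... | yes p | _     = yes (true , p)
  ... | no _  | yes q = yes (false , q)
  ... | no ¬p | no ¬q = no λ { (true , p) → ¬p p ; (false , q) → ¬q q }

module ListColourings where

  open import Data.Nat using (ℕ; zero; suc)
  open import Data.Fin as F using (Fin)
  import Data.Fin.Properties as Fin
  open import Data.Fin.Subset using (Subset; inside; outside; _-_; ⁅_⁆; _─_; _⊆_)
    renaming (_∈_ to _∈ₛ_; _∉_ to _∉ₛ_)
  open import Data.Fin.Subset.Properties using (_∈?_; drop-there; p─q⊆p; x∈⁅x⁆; x∈p∧x≢y⇒x∈p-y)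
  open import Data.Product using (_×_; _,_; proj₁; proj₂)
  open import Data.Empty using (⊥-elim)
  open import Data.Bool using (if_then_else_)
  open import Data.List using (List; _∷_; [_]; map; cartesianProductWith)
  open import Data.List.Membership.Propositional using (_∈_)
  open import Data.List.Membership.Propositional.Properties
    using (∈-cartesianProductWith⁺; ∈-cartesianProductWith⁻; ∈-map⁺; ∈-map⁻)
  open import Data.List.Relation.Unary.Any using (here)
  open import Data.List.Relation.Unary.Unique.Propositional using (Unique)
  import Data.List.Relation.Unary.All as All
  import Data.List.Relation.Unary.AllPairs as AllPairs
  import Data.List.Relation.Unary.Unique.Propositional.Properties as Unique
  open import Data.Vec using (Vec; []; _∷_; lookup; tabulate; _[_]≔_)
  open import Data.Vec.Base using () renaming (here to hereₛ; there to thereₛ)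
  import Data.Vec.Properties as Vec
  open import Relation.Binary.PropositionalEquality hiding ([_])
  open import Relation.Nullary using (Dec; yes; no; does)
  open import Function using (_∘_)

  private variable
    n : ℕ

  x∈p-y⇒x∈p : ∀ {p : Subset n} {x y} → x ∈ₛ p - y → x ∈ₛ p
  x∈p-y⇒x∈p {p = p} {y = y} = p─q⊆p p ⁅ y ⁆

  x∈p─q⇒x∉q : ∀ {p q : Subset n} {x} → x ∈ₛ p ─ q → x ∉ₛ q
  x∈p─q⇒x∉q {p = _ ∷ p} {outside ∷ q} (thereₛ x∈) (thereₛ x∈q) = x∈p─q⇒x∉q x∈ x∈q
  x∈p─q⇒x∉q {p = _ ∷ p} {inside  ∷ q} (thereₛ x∈) (thereₛ x∈q) = x∈p─q⇒x∉q x∈ x∈q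
  x∈p─q⇒x∉q {p = _ ∷ p} {outside ∷ q} hereₛ ()

  x∈p-y⇒x≢y : ∀ {p : Subset n} {x y} → x ∈ₛ p - y → x ≢ y
  x∈p-y⇒x≢y {y = y} x∈ refl = x∈p─q⇒x∉q x∈ (x∈⁅x⁆ y)

  Colouring : ℕ → Set
  Colouring n = Vec ℕ n

  vec-ext : ∀ {A : Set} {c c′ : Vec A n} → (∀ u → lookup c u ≡ lookup c′ u) → c ≡ c′
  vec-ext {c = c} {c′} h = trans (sym (Vec.tabulate∘lookup c)) (trans (Vec.tabulate-cong h) (Vec.tabulate∘lookup c′))

  -- Points outside S carry the dummy colour 0, so the colourings of S form a finite list.
  IsListColouring : (Fin n → List ℕ) → Subset n → Colouring n → Set
  IsListColouring lists S c = ∀ u → (u ∈ₛ S → lookup c u ∈ lists u) × (u ∉ₛ S → lookup c u ≡ 0)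

  listColourings : (Fin n → List ℕ) → Subset n → List (Colouring n)
  listColourings {zero}  lists []            = [ [] ]
  listColourings {suc n} lists (inside  ∷ S) = cartesianProductWith _∷_ (lists F.zero) (listColourings (lists ∘ F.suc) S)
  listColourings {suc n} lists (outside ∷ S) = map (0 ∷_) (listColourings (lists ∘ F.suc) S)

  ∈-listColourings⁻ : ∀ lists (S : Subset n) {c} → c ∈ listColourings lists S → IsListColouring lists S c
  ∈-listColourings⁻ {zero}  lists [] {[]} _ ()
  ∈-listColourings⁻ {suc n} lists (inside ∷ S) c∈
    with x , c′ , x∈ , c′∈ , refl ← ∈-cartesianProductWith⁻ _∷_ (lists F.zero) (listColourings (lists ∘ F.suc) S) c∈
    = λ where
      F.zero    → (λ _ → x∈) , (λ 0∉ → ⊥-elim (0∉ hereₛ))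
      (F.suc u) → (λ u∈ → proj₁ (rest u) (drop-there u∈)) , (λ u∉ → proj₂ (rest u) (u∉ ∘ thereₛ))
    where
    rest : IsListColouring (lists ∘ F.suc) S c′
    rest = ∈-listColourings⁻ (lists ∘ F.suc) S c′∈
  ∈-listColourings⁻ {suc n} lists (outside ∷ S) c∈
    with c′ , c′∈ , refl ← ∈-map⁻ (0 ∷_) c∈ = λ where
      F.zero    → (λ ()) , (λ _ → refl)
      (F.suc u) → (λ u∈ → proj₁ (rest u) (drop-there u∈)) , (λ u∉ → proj₂ (rest u) (u∉ ∘ thereₛ))
    where
    rest : IsListColouring (lists ∘ F.suc) S c′
    rest = ∈-listColourings⁻ (lists ∘ F.suc) S c′∈

  private
    tail : ∀ {lists : Fin (suc n) → List ℕ} {s S x c} →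
      IsListColouring lists (s ∷ S) (x ∷ c) → IsListColouring (lists ∘ F.suc) S c
    tail h u = proj₁ (h (F.suc u)) ∘ thereₛ , λ u∉ → proj₂ (h (F.suc u)) (u∉ ∘ drop-there)

  ∈-listColourings⁺ : ∀ lists (S : Subset n) {c} → IsListColouring lists S c → c ∈ listColourings lists S
  ∈-listColourings⁺ {zero}  lists []            {[]}    _ = here refl
  ∈-listColourings⁺ {suc n} lists (inside  ∷ S) {x ∷ c} h =
    ∈-cartesianProductWith⁺ _∷_ (proj₁ (h F.zero) hereₛ) (∈-listColourings⁺ (lists ∘ F.suc) S (tail h))
  ∈-listColourings⁺ {suc n} lists (outside ∷ S) {x ∷ c} h
    rewrite proj₂ (h F.zero) (λ ()) =
    ∈-map⁺ (0 ∷_) (∈-listColourings⁺ (lists ∘ F.suc) S (tail h))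

  listColourings-unique : ∀ lists (S : Subset n) → (∀ t → Unique (lists t)) → Unique (listColourings lists S)
  listColourings-unique {zero}  lists []            _    = All.[] AllPairs.∷ AllPairs.[]
  listColourings-unique {suc n} lists (inside  ∷ S) uniq =
    Unique.cartesianProductWith⁺ _∷_ Vec.∷-injective (uniq F.zero) (listColourings-unique (lists ∘ F.suc) S (uniq ∘ F.suc))
  listColourings-unique {suc n} lists (outside ∷ S) uniq =
    Unique.map⁺ (proj₂ ∘ Vec.∷-injective) (listColourings-unique (lists ∘ F.suc) S (uniq ∘ F.suc))

  restrict : Subset n → Colouring n → Colouring n
  restrict T c = tabulate λ u → if does (u ∈? T) then lookup c u else 0

  restrict-∈ : ∀ (T : Subset n) c {u} → u ∈ₛ T → lookup (restrict T c) u ≡ lookup c u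
  restrict-∈ T c {u} u∈ = trans (Vec.lookup∘tabulate _ u) (select (u ∈? T))
    where
    select : (d : Dec (u ∈ₛ T)) → (if does d then lookup c u else 0) ≡ lookup c u
    select (yes _)  = refl
    select (no u∉) = ⊥-elim (u∉ u∈)

  restrict-∉ : ∀ (T : Subset n) c {u} → u ∉ₛ T → lookup (restrict T c) u ≡ 0
  restrict-∉ T c {u} u∉ = trans (Vec.lookup∘tabulate _ u) (select (u ∈? T))
    where
    select : (d : Dec (u ∈ₛ T)) → (if does d then lookup c u else 0) ≡ 0
    select (yes u∈) = ⊥-elim (u∉ u∈)
    select (no _)   = refl

  removeAll : ∀ {r} → Subset n → (Fin r → Fin n) → Subset n
  removeAll {r = zero}  U h = U
  removeAll {r = suc r} U h = removeAll (U - h F.zero) (h ∘ F.suc)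

  ∈-removeAll⁻ : ∀ {r} {U : Subset n} (h : Fin r → Fin n) {u} → u ∈ₛ removeAll U h → u ∈ₛ U × (∀ w → u ≢ h w)
  ∈-removeAll⁻ {r = zero}  h u∈ = u∈ , λ ()
  ∈-removeAll⁻ {r = suc r} h u∈ with u∈U-h₀ , u≢h ← ∈-removeAll⁻ (h ∘ F.suc) u∈ =
    x∈p-y⇒x∈p u∈U-h₀ , λ { F.zero → x∈p-y⇒x≢y u∈U-h₀ ; (F.suc w) → u≢h w }

  ∈-removeAll⁺ : ∀ {r} {U : Subset n} (h : Fin r → Fin n) {u} → u ∈ₛ U → (∀ w → u ≢ h w) → u ∈ₛ removeAll U h
  ∈-removeAll⁺ {r = zero}  h u∈ _   = u∈
  ∈-removeAll⁺ {r = suc r} h u∈ u≢h =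
    ∈-removeAll⁺ (h ∘ F.suc) (x∈p∧x≢y⇒x∈p-y u∈ (u≢h F.zero)) (u≢h ∘ F.suc)

  module _ {lists : Fin n → List ℕ} where

    restrict-isListColouring : ∀ {S T c} → T ⊆ S → IsListColouring lists S c → IsListColouring lists T (restrict T c)
    restrict-isListColouring {T = T} {c} T⊆S h u =
      (λ u∈ → subst (_∈ lists u) (sym (restrict-∈ T c u∈)) (proj₁ (h u) (T⊆S u∈))) , restrict-∉ T c

    extend-isListColouring : ∀ {S v c x} → v ∈ₛ S → x ∈ lists v →
      IsListColouring lists (S - v) c → IsListColouring lists S (c [ v ]≔ x)
    extend-isListColouring {S} {v} {c} {x} v∈S x∈ h u with u Fin.≟ v
    ... | yes refl = (λ _ → subst (_∈ lists u) (sym (Vec.lookup∘update u c x)) x∈) , (λ u∉ → ⊥-elim (u∉ v∈S))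
    ... | no u≢v  =
      (λ u∈S → subst (_∈ lists u) (sym (Vec.lookup∘update′ u≢v c x)) (proj₁ (h u) (x∈p∧x≢y⇒x∈p-y u∈S u≢v))) ,
      (λ u∉S → trans (Vec.lookup∘update′ u≢v c x) (proj₂ (h u) (u∉S ∘ x∈p-y⇒x∈p)))

module NatArithmetic where

  open import Data.Nat using (ℕ; zero; suc; _+_; _*_; _^_; _∸_; _≤_; NonZero)
  open import Data.Nat.Properties
  open import Data.Nat.Tactic.RingSolver using (solve-∀)
  open import Relation.Binary.PropositionalEquality

  *-distribʳ-^ : ∀ a b r → (a * b) ^ r ≡ a ^ r * b ^ r
  *-distribʳ-^ a b zero    = refl
  *-distribʳ-^ a b (suc r) = trans (cong (a * b *_) (*-distribʳ-^ a b r)) ([m*n]*[o*p]≡[m*o]*[n*p] a b (a ^ r) (b ^ r))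

  growth-arithmetic : ∀ {A R K g G c} .{{_ : NonZero A}} →
    A * (R * g) ≤ A * G + c * g → suc K * c ≤ R * A → R * K * g ≤ suc K * G
  growth-arithmetic {A} {R} {K} {g} {G} {c} h₁ h₂ = *-cancelˡ-≤ A (+-cancelʳ-≤ (A * (R * g)) _ _ (begin
    A * (R * K * g) + A * (R * g)       ≡⟨ split K A R g ⟩
    suc K * (A * (R * g))               ≤⟨ *-monoʳ-≤ (suc K) h₁ ⟩
    suc K * (A * G + c * g)             ≡⟨ distribute K A G c g ⟩
    A * (suc K * G) + suc K * c * g     ≤⟨ +-monoʳ-≤ (A * (suc K * G)) (*-monoˡ-≤ g h₂) ⟩
    A * (suc K * G) + R * A * g         ≡⟨ cong (A * (suc K * G) +_) (regroup R A g) ⟩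
    A * (suc K * G) + A * (R * g)       ∎))
    where
    open ≤-Reasoning
    split : ∀ K A R g → A * (R * K * g) + A * (R * g) ≡ suc K * (A * (R * g))
    split = solve-∀
    distribute : ∀ K A G c g → suc K * (A * G + c * g) ≡ A * (suc K * G) + suc K * c * g
    distribute = solve-∀
    regroup : ∀ R A g → R * A * g ≡ A * (R * g)
    regroup = solve-∀

  bound-conversion : ∀ K′ R → BoundHolds (3 + K′) R →
    4 * (3 + K′) * (2 + K′) ^ (2 + K′) ≤ R * (R * (1 + K′)) ^ (1 + K′)
  bound-conversion K′ R hyp = <⇒≤ (begin-strict
    4 * k * κ ^ κ                     <⟨ *-cancelʳ-< K _ _ (begin-strict
                                           4 * k * κ ^ κ * K                ≡⟨ regroup (κ ^ κ) k K ⟩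
                                           κ ^ κ * (4 * k * K)              ≡⟨ cong (κ ^ κ *_) (m+n∸n≡m (4 * k * K) (8 * k)) ⟨
                                           κ ^ κ * (4 * k * K + 8 * k ∸ 8 * k)
                                                                            ≡⟨ cong (λ x → κ ^ κ * (x ∸ 8 * k)) (expand K′) ⟩
                                           κ ^ κ * (4 * k * k ∸ 8 * k)      <⟨ hyp ⟩
                                           R ^ κ * (K * K ^ K)              ≡⟨ *-assoc (R ^ κ) K (K ^ K) ⟨
                                           R ^ κ * K * K ^ K                ≡⟨ reorder (R ^ κ) K (K ^ K) ⟩
                                           R ^ κ * K ^ K * K                ∎) ⟩
    R ^ κ * K ^ K                     ≡⟨ *-assoc R (R ^ K) (K ^ K) ⟩
    R * (R ^ K * K ^ K)               ≡⟨ cong (R *_) (*-distribʳ-^ R K K) ⟨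
    R * (R * K) ^ K                   ∎)
    where
    open ≤-Reasoning
    k κ K : ℕ
    k = 3 + K′
    κ = 2 + K′
    K = 1 + K′
    regroup : ∀ p k K → 4 * k * p * K ≡ p * (4 * k * K)
    regroup = solve-∀
    expand : ∀ K′ → 4 * (3 + K′) * (1 + K′) + 8 * (3 + K′) ≡ 4 * (3 + K′) * (3 + K′)
    expand = solve-∀
    reorder : ∀ r K p → r * K * p ≡ r * p * K
    reorder = solve-∀

module Betweenness where

  open import Data.Nat using (suc; s≤s; z≤n)
  open import Data.Fin as F using (Fin; _<_)
  import Data.Fin.Properties as Fin
  open import Data.Product using (_×_; _,_)
  open import Data.Sum using (_⊎_; inj₁; inj₂)
  open import Data.Empty using (⊥-elim)
  open import Relation.Binary.PropositionalEquality
  open import Relation.Nullary using (¬_; yes; no)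

  StrictlyBetween : ∀ {C : Set} → (C → C → Set) → C → C → C → Set
  StrictlyBetween _≺_ x y z = (x ≺ y × y ≺ z) ⊎ (z ≺ y × y ≺ x)

  StrictlyBetween-flip : ∀ {C : Set} {_≺_ : C → C → Set} {x y z} →
    StrictlyBetween _≺_ x y z → StrictlyBetween (λ a b → b ≺ a) x y z
  StrictlyBetween-flip (inj₁ (x≺y , y≺z)) = inj₂ (y≺z , x≺y)
  StrictlyBetween-flip (inj₂ (z≺y , y≺x)) = inj₁ (y≺x , z≺y)

  module _ {C : Set} {_≺_ : C → C → Set}
           (≺-irrefl : ∀ {x} → ¬ x ≺ x) (≺-trans : ∀ {x y z} → x ≺ y → y ≺ z → x ≺ z) where

    between⇒monotone : ∀ {K} (h : Fin (suc K) → C) →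
      (∀ {a b c} → a < b → b < c → StrictlyBetween _≺_ (h a) (h b) (h c)) →
      h F.zero ≺ h (F.fromℕ K) → ∀ {a b} → a < b → h a ≺ h b
    between⇒monotone {K} h between ends = monotone
      where
      below-last : ∀ {a} → a < F.fromℕ K → h a ≺ h (F.fromℕ K)
      below-last {F.zero}  _      = ends
      below-last {F.suc a} a<last with between {F.zero} {F.suc a} (s≤s z≤n) a<last
      ... | inj₁ (_ , a≺last)       = a≺last
      ... | inj₂ (last≺a , a≺zero) = ⊥-elim (≺-irrefl (≺-trans ends (≺-trans last≺a a≺zero)))
      monotone : ∀ {a b} → a < b → h a ≺ h b
      monotone {a} {b} a<b with b Fin.≟ F.fromℕ K
      ... | yes refl  = below-last a<b
      ... | no b≢last = inside (Fin.≤∧≢⇒< (Fin.≤fromℕ b) b≢last)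
        where
        inside : b < F.fromℕ K → h a ≺ h b
        inside b<last with between a<b b<last
        ... | inj₁ (a≺b , _)      = a≺b
        ... | inj₂ (last≺b , b≺a) =
          ⊥-elim (≺-irrefl (≺-trans (below-last (Fin.<-trans a<b b<last)) (≺-trans last≺b b≺a)))

module RosenfeldCounting where

  open ListCounting
  open FinLemmas
  open ListColourings
  open NatArithmetic
  open import Data.Nat as ℕ using (ℕ; zero; suc; _+_; _*_; _^_; _≤_; _<_; z≤n; s≤s; NonZero)
  open import Data.Nat.Properties
  open import Data.Nat.ListAction using (sum)
  open import Data.Fin as F using (Fin)
  import Data.Fin.Properties as Fin
  open import Data.Fin.Subset using (Subset; ⊤; _-_; _⊆_; ∣_∣) renaming (_∈_ to _∈ₛ_; _∉_ to _∉ₛ_)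
  open import Data.Fin.Subset.Properties using (_∈?_; x∈p∧x≢y⇒x∈p-y; x∈p⇒∣p-x∣<∣p∣; ∣p─q∣≤∣p∣; ∈⊤)
  open import Data.Product using (Σ; ∃; _×_; _,_; proj₁; proj₂)
  open import Data.Sum as Sum using (_⊎_; inj₁; inj₂)
  open import Data.Empty using (⊥-elim)
  open import Data.Bool using (Bool; true; false)
  open import Data.List using (List; []; _∷_; length; filter; map; concatMap; cartesianProduct; allFin)
  open import Data.List.Properties using (length-tabulate; length-map)
  open import Data.List.Membership.Propositional using (_∈_; find)
  open import Data.List.Membership.Propositional.Properties
    using ( ∈-filter⁻; ∈-filter⁺; ∈-allFin; ∈-cartesianProduct⁺; ∈-cartesianProduct⁻
          ; ∈-concatMap⁺; ∈-concatMap⁻; ∈-map⁺; ∈-map⁻)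
  open import Data.List.Relation.Unary.Any as Any using (here; there)
  open import Data.List.Relation.Unary.Unique.Propositional using (Unique)
  import Data.List.Relation.Unary.Unique.Propositional.Properties as Unique
  open import Data.Vec using (Vec; lookup; _[_]≔_; replicate)
  import Data.Vec.Properties as Vec
  open import Relation.Binary.PropositionalEquality hiding ([_])
  open import Relation.Nullary using (¬_; Dec; yes; no)
  open import Relation.Nullary.Decidable using (_×-dec_; _⊎-dec_; ¬?; decidable-stable)
  open import Function using (_∘_; id)

  record OrderedLineSystem (n m k : ℕ) : Set₁ where
    field
      On                  : Fin m → Fin n → Set
      on?                 : ∀ i t → Dec (On i t)
      Ordering            : Fin m → (Fin k → Fin n) → Set
      ordering?           : ∀ i f → Dec (Ordering i f)
      ordering-unique     : ∀ {i f g} → Ordering i f → Ordering i g → ∀ a → f a ≡ g a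
      ordering-injective  : ∀ {i f} → Ordering i f → ∀ {a b} → f a ≡ f b → a ≡ b
      ordering-on         : ∀ {i f} → Ordering i f → ∀ a → On i (f a)
      ordering-onto       : ∀ {i f} → Ordering i f → ∀ {t} → On i t → ∃ λ a → f a ≡ t
      meet-at-most-once   : ∀ {i j s t} → i ≢ j → On i s → On j s → On i t → On j t → s ≡ t
      no-three-concurrent : ∀ {i j l t} → i ≢ j → j ≢ l → i ≢ l → ¬ (On i t × On j t × On l t)
      at-most-k-points    : ∀ i → Σ (Fin k → Fin n) λ e → ∀ {t} → On i t → ∃ λ a → e a ≡ t

  module Repetitions {n m k : ℕ} (𝓛 : OrderedLineSystem n m k) where

    open OrderedLineSystem 𝓛

    Meet : Fin m → Fin m → Set
    Meet i j = ∃ λ t → On i t × On j t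

    meet? : ∀ i j → Dec (Meet i j)
    meet? i j = Fin.any? λ t → on? i t ×-dec on? j t

    -- The common point of two lines may sit at the same position of both sequences.
    Agree : Subset n → Colouring n → Fin n → Fin n → Set
    Agree S c s t = s ≡ t ⊎ (s ∈ₛ S × t ∈ₛ S × lookup c s ≡ lookup c t)

    Matching : Subset n → Colouring n → (Fin k → Fin n) → (Fin k → Fin n) → Set
    Matching S c f g = ∀ x → Agree S c (f x) (g x)

    agree? : ∀ S c s t → Dec (Agree S c s t)
    agree? S c s t = (s Fin.≟ t) ⊎-dec (s ∈? S ×-dec t ∈? S ×-dec lookup c s ℕ.≟ lookup c t)

    -- Orderings are quantified over vectors so that a repetition can be searched for.
    RepetitionAlong : Subset n → Colouring n → Fin m → Fin m → Bool → Set
    RepetitionAlong S c i j d = Σ (Vec (Fin n) k) λ u → Σ (Vec (Fin n) k) λ w →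
      Ordering i (lookup u) × Ordering j (lookup w) × Matching S c (lookup u) (oriented d (lookup w))

    Repetition : Subset n → Colouring n → Set
    Repetition S c = Σ (Fin m) λ i → Σ (Fin m) λ j → i ≢ j × Meet i j × Σ Bool (RepetitionAlong S c i j)

    opaque
      matching? : ∀ S c f g → Dec (Matching S c f g)
      matching? S c f g = Fin.all? λ x → agree? S c (f x) (g x)

      repetition? : ∀ S c → Dec (Repetition S c)
      repetition? S c = Fin.any? λ i → Fin.any? λ j → ¬? (i Fin.≟ j) ×-dec meet? i j ×-dec
        any-bool? λ d → any-vec? k λ u → any-vec? k λ w →
          ordering? i (lookup u) ×-dec ordering? j (lookup w) ×-dec matching? S c (lookup u) (oriented d (lookup w))

    matching-mono : ∀ {T U c c′ f g} → T ⊆ U → (∀ {u} → u ∈ₛ T → lookup c u ≡ lookup c′ u) →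
      Matching T c f g → Matching U c′ f g
    matching-mono T⊆U agree M x with M x
    ... | inj₁ eq                = inj₁ eq
    ... | inj₂ (s∈ , t∈ , same) = inj₂ (T⊆U s∈ , T⊆U t∈ , trans (sym (agree s∈)) (trans same (agree t∈)))

    repetition-mono : ∀ {T U c c′} → T ⊆ U → (∀ {u} → u ∈ₛ T → lookup c u ≡ lookup c′ u) →
      Repetition T c → Repetition U c′
    repetition-mono {c = c} {c′} T⊆U agree (i , j , i≢j , meet , d , u , w , o₁ , o₂ , M) =
      i , j , i≢j , meet , d , u , w , o₁ , o₂ , matching-mono {c = c} {c′} T⊆U agree M

    Involves : Fin n → (Fin k → Fin n) → (Fin k → Fin n) → Set
    Involves v f g = Σ (Fin k) λ x → f x ≢ g x × (f x ≡ v ⊎ g x ≡ v)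

    agree-sym : ∀ {S c s t} → Agree S c s t → Agree S c t s
    agree-sym (inj₁ eq)                = inj₁ (sym eq)
    agree-sym (inj₂ (s∈ , t∈ , same)) = inj₂ (t∈ , s∈ , sym same)

    matching-swap : ∀ d {S c f g} → Matching S c f (oriented d g) → Matching S c g (oriented d f)
    matching-swap d {S} {c} {f} {g} M y = agree-sym {S} {c} (oriented-swap-∀ d {P = Agree S c} {f} {g} M y)

    involves-swap : ∀ d {v f g} → Involves v f (oriented d g) → Involves v g (oriented d f)
    involves-swap d {v} {f} {g} h
      with y , f≢g , one-is-v ← oriented-swap-∃ d {P = λ s t → s ≢ t × (s ≡ v ⊎ t ≡ v)} {f} {g} h =
      y , f≢g ∘ sym , Sum.swap one-is-v

  module Nonrepetitive {n m K′ : ℕ} (𝓛 : OrderedLineSystem n m (3 + K′))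
    (lists : Fin n → List ℕ) (lists-unique : ∀ t → Unique (lists t))
    (R : ℕ) (R≤∣lists∣ : ∀ t → R ≤ length (lists t))
    (bound : 4 * (3 + K′) * (2 + K′) ^ (2 + K′) ≤ R * (R * (1 + K′)) ^ (1 + K′)) where

    open OrderedLineSystem 𝓛

    open Repetitions 𝓛

    k K κ β : ℕ
    k = 3 + K′
    K = 1 + K′
    κ = 2 + K′
    β = R * K

    opaque
      good : Subset n → List (Colouring n)
      good S = filter (¬? ∘ repetition? S) (listColourings lists S)

      ∈-good⁻ : ∀ {S c} → c ∈ good S → IsListColouring lists S c × ¬ Repetition S c
      ∈-good⁻ {S} c∈ with c∈′ , nonrep ← ∈-filter⁻ (¬? ∘ repetition? S) {xs = listColourings lists S} c∈ =
        ∈-listColourings⁻ lists S c∈′ , nonrep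

      ∈-good⁺ : ∀ {S c} → IsListColouring lists S c → ¬ Repetition S c → c ∈ good S
      ∈-good⁺ {S} col nonrep = ∈-filter⁺ (¬? ∘ repetition? S) (∈-listColourings⁺ lists S col) nonrep

      good-unique : ∀ S → Unique (good S)
      good-unique S = Unique.filter⁺ (¬? ∘ repetition? S) (listColourings-unique lists S lists-unique)

    #good : Subset n → ℕ
    #good S = length (good S)

    Growth : Subset n → Set
    Growth S = ∀ {w} → w ∈ₛ S → β * #good (S - w) ≤ κ * #good S

    GrowthBelow : ℕ → Set
    GrowthBelow N = ∀ S → ∣ S ∣ < N → Growth S

    growth-removeAll : ∀ {N} → GrowthBelow N → ∀ {r} U → ∣ U ∣ < N → (h : Fin r → Fin n) →
      (∀ {a b} → h a ≡ h b → a ≡ b) → (∀ a → h a ∈ₛ U) →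
      β ^ r * #good (removeAll U h) ≤ κ ^ r * #good U
    growth-removeAll ih {zero}  U ∣U∣<N h inj h∈U = ≤-refl
    growth-removeAll ih {suc r} U ∣U∣<N h inj h∈U = begin
      β * β ^ r * #good (removeAll U′ (h ∘ F.suc))   ≡⟨ *-assoc β (β ^ r) _ ⟩
      β * (β ^ r * #good (removeAll U′ (h ∘ F.suc))) ≤⟨ *-monoʳ-≤ β rest ⟩
      β * (κ ^ r * #good U′)                         ≡⟨ x∙yz≈y∙xz β (κ ^ r) _ ⟩
      κ ^ r * (β * #good U′)                         ≤⟨ *-monoʳ-≤ (κ ^ r) (ih U ∣U∣<N (h∈U F.zero)) ⟩
      κ ^ r * (κ * #good U)                          ≡⟨ x∙yz≈y∙xz (κ ^ r) κ _ ⟩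
      κ * (κ ^ r * #good U)                          ≡⟨ *-assoc κ (κ ^ r) _ ⟨
      κ * κ ^ r * #good U                            ∎
      where
      open ≤-Reasoning
      open import Algebra.Properties.CommutativeSemigroup *-commutativeSemigroup using (x∙yz≈y∙xz)
      U′ : Subset n
      U′ = U - h F.zero
      rest : β ^ r * #good (removeAll U′ (h ∘ F.suc)) ≤ κ ^ r * #good U′
      rest = growth-removeAll ih U′ (≤-<-trans (∣p─q∣≤∣p∣ U _) ∣U∣<N) (h ∘ F.suc) (Fin.suc-injective ∘ inj)
        (λ a → x∈p∧x≢y⇒x∈p-y (h∈U (F.suc a)) (λ eq → Fin.0≢1+n (sym (inj eq))))

    module GrowthStep (S : Subset n) {v : Fin n} (v∈S : v ∈ₛ S) (ih : GrowthBelow ∣ S ∣) where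

      U : Subset n
      U = S - v

      g₀ : ℕ
      g₀ = #good U

      Extension : Set
      Extension = Colouring n × ℕ

      extend : Extension → Colouring n
      extend (c , x) = c [ v ]≔ x

      extensions : List Extension
      extensions = cartesianProduct (good U) (lists v)

      extensions-unique : Unique extensions
      extensions-unique = Unique.cartesianProduct⁺ (good-unique U) (lists-unique v)

      length-extensions : length extensions ≡ g₀ * length (lists v)
      length-extensions = length-cartesianProduct (good U) (lists v)

      extend-agrees : ∀ p {u} → u ≢ v → lookup (extend p) u ≡ lookup (proj₁ p) u
      extend-agrees (c , x) u≢v = Vec.lookup∘update′ u≢v c x

      module _ {p : Extension} (p∈ : p ∈ extensions) where

        ∈-extensions⁻ : proj₁ p ∈ good U × proj₂ p ∈ lists v
        ∈-extensions⁻ = ∈-cartesianProduct⁻ (good U) (lists v) p∈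

        base-good : IsListColouring lists U (proj₁ p) × ¬ Repetition U (proj₁ p)
        base-good = ∈-good⁻ (proj₁ ∈-extensions⁻)

        extension-isListColouring : IsListColouring lists S (extend p)
        extension-isListColouring = extend-isListColouring {c = proj₁ p} v∈S (proj₂ ∈-extensions⁻) (proj₁ base-good)

      extend-injective : ∀ {p q} → p ∈ extensions → q ∈ extensions → extend p ≡ extend q → p ≡ q
      extend-injective {c₁ , x₁} {c₂ , x₂} p∈ q∈ eq = cong₂ _,_ (vec-ext same-colour) same-x
        where
        same-x : x₁ ≡ x₂
        same-x = trans (sym (Vec.lookup∘update v c₁ x₁)) (trans (cong (λ c → lookup c v) eq) (Vec.lookup∘update v c₂ x₂))
        v∉U : v ∉ₛ U
        v∉U v∈U = x∈p-y⇒x≢y v∈U refl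
        same-colour : ∀ u → lookup c₁ u ≡ lookup c₂ u
        same-colour u with u Fin.≟ v
        ... | yes refl = trans (proj₂ (proj₁ (base-good p∈) u) v∉U) (sym (proj₂ (proj₁ (base-good q∈) u) v∉U))
        ... | no u≢v   = trans (sym (extend-agrees (c₁ , x₁) u≢v))
                           (trans (cong (λ c → lookup c u) eq) (extend-agrees (c₂ , x₂) u≢v))

      -- ((i , j) , d): line i through v, a line j meeting it, and their relative direction d.
      Descriptor : Set
      Descriptor = (Fin m × Fin m) × Bool

      NewRepetition : Descriptor → Extension → Set
      NewRepetition ((i , j) , d) p = Σ (Vec (Fin n) k) λ u → Σ (Vec (Fin n) k) λ w →
        Ordering i (lookup u) × Ordering j (lookup w) ×
        Matching S (extend p) (lookup u) (oriented d (lookup w)) × Involves v (lookup u) (oriented d (lookup w))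

      opaque
        newRepetition? : ∀ D p → Dec (NewRepetition D p)
        newRepetition? ((i , j) , d) p = any-vec? k λ u → any-vec? k λ w →
          ordering? i (lookup u) ×-dec ordering? j (lookup w) ×-dec
          matching? S (extend p) (lookup u) (oriented d (lookup w)) ×-dec
          Fin.any? (λ x → ¬? (lookup u x Fin.≟ oriented d (lookup w) x) ×-dec
                           (lookup u x Fin.≟ v ⊎-dec oriented d (lookup w) x Fin.≟ v))

      linesThrough : List (Fin m)
      linesThrough = filter (λ i → on? i v) (allFin m)

      ∈-linesThrough⁻ : ∀ {i} → i ∈ linesThrough → On i v
      ∈-linesThrough⁻ i∈ = proj₂ (∈-filter⁻ (λ i → on? i v) {xs = allFin m} i∈)

      neighbour? : ∀ i j → Dec (i ≢ j × Meet i j)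
      neighbour? i j = ¬? (i Fin.≟ j) ×-dec meet? i j

      neighbours : Fin m → List (Fin m)
      neighbours i = filter (neighbour? i) (allFin m)

      ∈-neighbours⁻ : ∀ {i j} → j ∈ neighbours i → i ≢ j × Meet i j
      ∈-neighbours⁻ {i} j∈ = proj₂ (∈-filter⁻ (neighbour? i) {xs = allFin m} j∈)

      descriptors : List Descriptor
      descriptors = cartesianProduct (concatMap (λ i → map (i ,_) (neighbours i)) linesThrough) (true ∷ false ∷ [])

      ∈-descriptors⁺ : ∀ {i j} d → On i v → i ≢ j → Meet i j → ((i , j) , d) ∈ descriptors
      ∈-descriptors⁺ d v-on-i i≢j meet = ∈-cartesianProduct⁺
        (∈-concatMap⁺ (λ i → map (i ,_) (neighbours i))
          (Any.map (λ { refl → ∈-map⁺ (_ ,_) (∈-filter⁺ (neighbour? _) (∈-allFin _) (i≢j , meet)) })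
            (∈-filter⁺ (λ i → on? i v) (∈-allFin _) v-on-i)))
        (bool∈ d)
        where
        bool∈ : ∀ d → d ∈ true ∷ false ∷ []
        bool∈ true  = here refl
        bool∈ false = there (here refl)

      ∈-descriptors⁻ : ∀ {i j d} → ((i , j) , d) ∈ descriptors → On i v × i ≢ j
      ∈-descriptors⁻ D∈
        with ij∈ , _ ← ∈-cartesianProduct⁻ _ _ D∈
        with i′ , i′∈ , ij∈′ ← find (∈-concatMap⁻ (λ i → map (i ,_) (neighbours i)) ij∈)
        with j′ , j′∈ , refl ← ∈-map⁻ (i′ ,_) ij∈′ =
          ∈-linesThrough⁻ i′∈ , proj₁ (∈-neighbours⁻ j′∈)

      length-linesThrough : length linesThrough ≤ 2
      length-linesThrough = length-≤2 (Unique.filter⁺ (λ i → on? i v) (Unique.allFin⁺ m))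
        λ a∈ b∈ c∈ a≢b b≢c a≢c →
          no-three-concurrent a≢b b≢c a≢c (∈-linesThrough⁻ a∈ , ∈-linesThrough⁻ b∈ , ∈-linesThrough⁻ c∈)

      length-neighbours : ∀ i → length (neighbours i) ≤ k
      length-neighbours i = subst (length (neighbours i) ≤_) (length-tabulate id)
        (length-≤-injection position (Unique.filter⁺ (neighbour? i) (Unique.allFin⁺ m)) (λ _ → ∈-allFin _) position-injective)
        where
        e : Fin k → Fin n
        e = proj₁ (at-most-k-points i)
        position-of : ∀ {j} → Dec (Meet i j) → Fin k
        position-of (yes (t , t-on-i , _)) = proj₁ (proj₂ (at-most-k-points i) t-on-i)
        position-of (no _)                 = F.zero
        position : Fin m → Fin k
        position j = position-of (meet? i j)
        position-on : ∀ {j} (m? : Dec (Meet i j)) → Meet i j → On i (e (position-of m?)) × On j (e (position-of m?))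
        position-on (yes (t , t-on-i , t-on-j)) _ with a , refl ← proj₂ (at-most-k-points i) t-on-i = t-on-i , t-on-j
        position-on (no ¬meet) meet = ⊥-elim (¬meet meet)
        position-injective : ∀ {j j′} → j ∈ neighbours i → j′ ∈ neighbours i → position j ≡ position j′ → j ≡ j′
        position-injective {j} {j′} j∈ j′∈ eq with j Fin.≟ j′
        ... | yes j≡j′ = j≡j′
        ... | no j≢j′  = ⊥-elim (no-three-concurrent i≢j j≢j′ i≢j′
              (proj₁ (position-on (meet? i j) meet) , proj₂ (position-on (meet? i j) meet) ,
               subst (λ a → On j′ (e a)) (sym eq) (proj₂ (position-on (meet? i j′) meet′))))
          where
          i≢j : i ≢ j
          i≢j = proj₁ (∈-neighbours⁻ j∈)
          i≢j′ : i ≢ j′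
          i≢j′ = proj₁ (∈-neighbours⁻ j′∈)
          meet : Meet i j
          meet = proj₂ (∈-neighbours⁻ j∈)
          meet′ : Meet i j′
          meet′ = proj₂ (∈-neighbours⁻ j′∈)

      length-descriptors : length descriptors ≤ 4 * k
      length-descriptors = begin
        length descriptors                          ≡⟨ length-cartesianProduct pairs (true ∷ false ∷ []) ⟩
        length pairs * 2                            ≡⟨ cong (_* 2) (length-concatMap neighbourPairs linesThrough) ⟩
        sum (map (length ∘ neighbourPairs) linesThrough) * 2
          ≤⟨ *-monoˡ-≤ 2 (sum-map-≤ k (length ∘ neighbourPairs) linesThrough λ {i} _ →
               ≤-trans (≤-reflexive (length-map (i ,_) (neighbours i))) (length-neighbours i)) ⟩
        length linesThrough * k * 2                 ≤⟨ *-monoˡ-≤ 2 (*-monoˡ-≤ k length-linesThrough) ⟩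
        2 * k * 2                                   ≡⟨ *-comm (2 * k) 2 ⟩
        2 * (2 * k)                                 ≡⟨ *-assoc 2 2 k ⟨
        4 * k                                       ∎
        where
        open ≤-Reasoning
        neighbourPairs : Fin m → List (Fin m × Fin m)
        neighbourPairs i = map (i ,_) (neighbours i)
        pairs : List (Fin m × Fin m)
        pairs = concatMap neighbourPairs linesThrough

      repetition⇒newRepetition : ∀ {p} → p ∈ extensions → Repetition S (extend p) →
        Σ Descriptor λ D → D ∈ descriptors × NewRepetition D p
      repetition⇒newRepetition {p} p∈ (i , j , i≢j , meet@(t , t-on-i , t-on-j) , d , u , w , o₁ , o₂ , M) =
        new (Fin.¬∀⟶∃¬ k _ (λ x → agree? U (proj₁ p) (f x) (g x)) not-old)
        where
        f g : Fin k → Fin n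
        f = lookup u
        g = oriented d (lookup w)
        not-old : ¬ Matching U (proj₁ p) f g
        not-old M′ = proj₂ (base-good p∈) (i , j , i≢j , meet , d , u , w , o₁ , o₂ , M′)
        new : (∃ λ x → ¬ Agree U (proj₁ p) (f x) (g x)) → Σ Descriptor λ D → D ∈ descriptors × NewRepetition D p
        new (x , ¬agree) with M x | f x Fin.≟ v | g x Fin.≟ v
        ... | inj₁ eq | _ | _ = ⊥-elim (¬agree (inj₁ eq))
        ... | inj₂ _ | yes fx≡v | _ =
          ((i , j) , d) , ∈-descriptors⁺ d (subst (On i) fx≡v (ordering-on o₁ x)) i≢j meet ,
          u , w , o₁ , o₂ , M , x , ¬agree ∘ inj₁ , inj₁ fx≡v
        ... | inj₂ _ | no _ | yes gx≡v =
          ((j , i) , d) , ∈-descriptors⁺ d (subst (On j) gx≡v (oriented-on d {P = On j} (ordering-on o₂) x)) (i≢j ∘ sym)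
                            (t , t-on-j , t-on-i) ,
          w , u , o₂ , o₁ , matching-swap d {c = extend p} M , involves-swap d (x , ¬agree ∘ inj₁ , inj₂ gx≡v)
        ... | inj₂ (fx∈ , gx∈ , same) | no fx≢v | no gx≢v = ⊥-elim (¬agree (inj₂
          (x∈p∧x≢y⇒x∈p-y fx∈ fx≢v , x∈p∧x≢y⇒x∈p-y gx∈ gx≢v ,
           trans (sym (extend-agrees p fx≢v)) (trans same (extend-agrees p gx≢v)))))

      -- All coincidences f y ≡ g x of the two lines involve one position z, distinct from the position xv of v.
      -- The points f x with x ∉ {z , xv} are removed to form T; their colours are copied from the points g x,
      -- which lie in T, so an extension realising the descriptor is determined by its restriction to T.
      module FixedDescriptor {i j : Fin m} {d : Bool} (i≢j : i ≢ j) (v-on-i : On i v)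
        {u w : Vec (Fin n) k} (o₁ : Ordering i (lookup u)) (o₂ : Ordering j (lookup w))
        {c₀ : Colouring n} (M₀ : Matching S c₀ (lookup u) (oriented d (lookup w)))
        (involves : Involves v (lookup u) (oriented d (lookup w))) where

        f g : Fin k → Fin n
        f = lookup u
        g = oriented d (lookup w)

        f-injective : ∀ {a b} → f a ≡ f b → a ≡ b
        f-injective = ordering-injective o₁

        g-injective : ∀ {a b} → g a ≡ g b → a ≡ b
        g-injective = oriented-injective d (ordering-injective o₂)

        g-on : ∀ a → On j (g a)
        g-on = oriented-on d {P = On j} (ordering-on o₂)

        crossing-unique : ∀ {a b a′ b′} → f a ≡ g b → f a′ ≡ g b′ → a ≡ a′ × b ≡ b′
        crossing-unique {a} {b} {a′} {b′} e e′ = a≡a′ , g-injective (trans (sym e) (trans (cong f a≡a′) e′))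
          where
          a≡a′ : a ≡ a′
          a≡a′ = f-injective (meet-at-most-once i≢j (ordering-on o₁ a) (subst (On j) (sym e) (g-on b))
                                                    (ordering-on o₁ a′) (subst (On j) (sym e′) (g-on b′)))

        xv : Fin k
        xv = proj₁ (ordering-onto o₁ v-on-i)

        f-xv : f xv ≡ v
        f-xv = proj₂ (ordering-onto o₁ v-on-i)

        v-unmatched : f xv ≢ g xv
        v-unmatched = unmatched involves
          where
          unmatched : Involves v f g → f xv ≢ g xv
          unmatched (x , fx≢gx , inj₁ fx≡v) f≡g with refl ← f-injective (trans fx≡v (sym f-xv)) = fx≢gx f≡g
          unmatched (x , fx≢gx , inj₂ gx≡v) f≡g with refl ← g-injective (trans gx≡v (trans (sym f-xv) f≡g)) = fx≢gx f≡g

        Separating : Fin k → Set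
        Separating z = xv ≢ z × (∀ {x y} → x ≢ z → y ≢ z → g x ≢ f y)

        separating : Σ (Fin k) Separating
        separating with Fin.any? (λ a → Fin.any? (λ b → f a Fin.≟ g b))
        ... | no ¬crossing = F.punchIn xv F.zero , Fin.punchInᵢ≢i xv F.zero ∘ sym ,
                             λ _ _ gx≡fy → ¬crossing (_ , _ , sym gx≡fy)
        ... | yes (a , b , fa≡gb) with xv Fin.≟ b
        ...   | yes refl = a , (λ xv≡a → v-unmatched (trans (cong f xv≡a) fa≡gb)) ,
                           λ _ y≢a gx≡fy → y≢a (proj₁ (crossing-unique (sym gx≡fy) fa≡gb))
        ...   | no xv≢b  = b , xv≢b , λ x≢b _ gx≡fy → x≢b (proj₂ (crossing-unique (sym gx≡fy) fa≡gb))

        z : Fin k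
        z = proj₁ separating

        xv≢z : xv ≢ z
        xv≢z = proj₁ (proj₂ separating)

        no-crossing : ∀ {x y} → x ≢ z → y ≢ z → g x ≢ f y
        no-crossing = proj₂ (proj₂ separating)

        matched-in-S : ∀ {x} → x ≢ z → f x ∈ₛ S × g x ∈ₛ S
        matched-in-S {x} x≢z with M₀ x
        ... | inj₁ fx≡gx             = ⊥-elim (no-crossing x≢z x≢z (sym fx≡gx))
        ... | inj₂ (fx∈ , gx∈ , _) = fx∈ , gx∈

        yv : Fin κ
        yv = F.punchOut (xv≢z ∘ sym)

        others : Fin K → Fin n
        others a = f (F.punchIn z (F.punchIn yv a))

        others-injective : ∀ {a b} → others a ≡ others b → a ≡ b
        others-injective = Fin.punchIn-injective yv _ _ ∘ Fin.punchIn-injective z _ _ ∘ f-injective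

        others-in-U : ∀ a → others a ∈ₛ U
        others-in-U a = x∈p∧x≢y⇒x∈p-y (proj₁ (matched-in-S (Fin.punchInᵢ≢i z _))) λ others≡v →
          Fin.punchInᵢ≢i yv a (Fin.punchIn-injective z _ _ (f-injective
            (trans others≡v (trans (sym f-xv) (cong f (sym (Fin.punchIn-punchOut (xv≢z ∘ sym))))))))

        T : Subset n
        T = removeAll U others

        T⊆U : T ⊆ U
        T⊆U t∈ = proj₁ (∈-removeAll⁻ others t∈)

        T⊆S : T ⊆ S
        T⊆S = x∈p-y⇒x∈p ∘ T⊆U

        ∈T⁺ : ∀ {t} → t ∈ₛ S → (∀ {x} → x ≢ z → t ≢ f x) → t ∈ₛ T
        ∈T⁺ t∈S t≢f = ∈-removeAll⁺ others (x∈p∧x≢y⇒x∈p-y t∈S (λ t≡v → t≢f xv≢z (trans t≡v (sym f-xv))))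
          λ a → t≢f (Fin.punchInᵢ≢i z _)

        g-in-T : ∀ {x} → x ≢ z → g x ∈ₛ T
        g-in-T x≢z = ∈T⁺ (proj₂ (matched-in-S x≢z)) (no-crossing x≢z)

        D : Descriptor
        D = (i , j) , d

        realised : List Extension
        realised = filter (newRepetition? D) extensions

        realised-matching : ∀ {p} → NewRepetition D p → Matching S (extend p) f g
        realised-matching {p} (u′ , w′ , o₁′ , o₂′ , M , _) x =
          subst₂ (Agree S (extend p)) (ordering-unique o₁′ o₁ x) (oriented-cong d (ordering-unique o₂′ o₂) x) (M x)

        colour-copied : ∀ {p} → NewRepetition D p → ∀ {x} → x ≢ z → lookup (extend p) (f x) ≡ lookup (extend p) (g x)
        colour-copied {p} q {x} x≢z with realised-matching {p} q x
        ... | inj₁ fx≡gx           = ⊥-elim (no-crossing x≢z x≢z (sym fx≡gx))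
        ... | inj₂ (_ , _ , same) = same

        restrict-∈-good : ∀ {p} → p ∈ extensions → restrict T (extend p) ∈ good T
        restrict-∈-good {p} p∈ = ∈-good⁺ (restrict-isListColouring {c = extend p} T⊆S (extension-isListColouring p∈))
          (proj₂ (base-good p∈) ∘ repetition-mono {c = restrict T (extend p)} {proj₁ p} T⊆U agrees)
          where
          agrees : ∀ {t} → t ∈ₛ T → lookup (restrict T (extend p)) t ≡ lookup (proj₁ p) t
          agrees t∈ = trans (restrict-∈ T (extend p) t∈) (extend-agrees p (x∈p-y⇒x≢y (T⊆U t∈)))

        restrict-injective : ∀ {p₁ p₂} → p₁ ∈ realised → p₂ ∈ realised →
          restrict T (extend p₁) ≡ restrict T (extend p₂) → p₁ ≡ p₂
        restrict-injective {p₁} {p₂} p₁∈ p₂∈ eq = extend-injective p₁∈′ p₂∈′ (vec-ext pointwise)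
          where
          p₁∈′ : p₁ ∈ extensions
          p₁∈′ = proj₁ (∈-filter⁻ (newRepetition? D) {xs = extensions} p₁∈)
          p₂∈′ : p₂ ∈ extensions
          p₂∈′ = proj₁ (∈-filter⁻ (newRepetition? D) {xs = extensions} p₂∈)
          q₁ : NewRepetition D p₁
          q₁ = proj₂ (∈-filter⁻ (newRepetition? D) {xs = extensions} p₁∈)
          q₂ : NewRepetition D p₂
          q₂ = proj₂ (∈-filter⁻ (newRepetition? D) {xs = extensions} p₂∈)
          same-on-T : ∀ {t} → t ∈ₛ T → lookup (extend p₁) t ≡ lookup (extend p₂) t
          same-on-T t∈ = trans (sym (restrict-∈ T (extend p₁) t∈))
                           (trans (cong (λ c → lookup c _) eq) (restrict-∈ T (extend p₂) t∈))
          pointwise : ∀ t → lookup (extend p₁) t ≡ lookup (extend p₂) t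
          pointwise t = by-cases (t ∈? T) (t ∈? S) (Fin.any? λ x → ¬? (x Fin.≟ z) ×-dec (t Fin.≟ f x))
            where
            open ≡-Reasoning
            by-cases : Dec (t ∈ₛ T) → Dec (t ∈ₛ S) → Dec (∃ λ x → x ≢ z × t ≡ f x) →
                       lookup (extend p₁) t ≡ lookup (extend p₂) t
            by-cases (yes t∈T) _         _           = same-on-T t∈T
            by-cases (no _)    (no t∉S)  _           = trans (proj₂ (extension-isListColouring p₁∈′ t) t∉S)
                                                         (sym (proj₂ (extension-isListColouring p₂∈′ t) t∉S))
            by-cases (no t∉T)  (yes t∈S) (no ¬copy)  =
              ⊥-elim (t∉T (∈T⁺ t∈S λ x≢z t≡fx → ¬copy (_ , x≢z , t≡fx)))
            by-cases (no _)    (yes _)   (yes (x , x≢z , t≡fx)) = begin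
              lookup (extend p₁) t      ≡⟨ cong (lookup (extend p₁)) t≡fx ⟩
              lookup (extend p₁) (f x)  ≡⟨ colour-copied {p₁} q₁ x≢z ⟩
              lookup (extend p₁) (g x)  ≡⟨ same-on-T (g-in-T x≢z) ⟩
              lookup (extend p₂) (g x)  ≡⟨ colour-copied {p₂} q₂ x≢z ⟨
              lookup (extend p₂) (f x)  ≡⟨ cong (lookup (extend p₂)) t≡fx ⟨
              lookup (extend p₂) t      ∎

        bound-realised : β ^ K * length realised ≤ κ ^ K * g₀
        bound-realised = begin
          β ^ K * length realised ≤⟨ *-monoʳ-≤ (β ^ K) (length-≤-injection (restrict T ∘ extend)
                                       (Unique.filter⁺ (newRepetition? D) extensions-unique)
                                       (restrict-∈-good ∘ proj₁ ∘ ∈-filter⁻ (newRepetition? D) {xs = extensions})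
                                       restrict-injective) ⟩
          β ^ K * #good T         ≤⟨ growth-removeAll ih U (x∈p⇒∣p-x∣<∣p∣ v∈S) others others-injective others-in-U ⟩
          κ ^ K * g₀              ∎
          where open ≤-Reasoning

      new-bound : ∀ {D} → D ∈ descriptors → β ^ K * length (filter (newRepetition? D) extensions) ≤ κ ^ K * g₀
      new-bound {D} D∈ with filter (newRepetition? D) extensions in eq
      ... | []     = subst (_≤ κ ^ K * g₀) (sym (*-zeroʳ (β ^ K))) z≤n
      ... | p₀ ∷ _
        with p₀∈ , (u , w , o₁ , o₂ , M₀ , involves)
               ← ∈-filter⁻ (newRepetition? D) {xs = extensions} (subst (p₀ ∈_) (sym eq) (here refl)) =
        subst (λ ps → β ^ K * length ps ≤ κ ^ K * g₀) eq
          (FixedDescriptor.bound-realised (proj₂ (∈-descriptors⁻ D∈)) (proj₁ (∈-descriptors⁻ D∈))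
             {u} {w} o₁ o₂ {extend p₀} M₀ involves)

      step-inequality : β ^ K * (R * g₀) ≤ β ^ K * #good S + 4 * k * κ ^ K * g₀
      step-inequality = begin
        β ^ K * (R * g₀)
          ≤⟨ *-monoʳ-≤ (β ^ K) (≤-trans (≤-reflexive (*-comm R g₀)) (*-monoʳ-≤ g₀ (R≤∣lists∣ v))) ⟩
        β ^ K * (g₀ * length (lists v))
          ≡⟨ cong (β ^ K *_) (trans (sym length-extensions) (length-partition nonrep? extensions)) ⟩
        β ^ K * (length nonrepetitive + length repetitive)
          ≡⟨ *-distribˡ-+ (β ^ K) _ _ ⟩
        β ^ K * length nonrepetitive + β ^ K * length repetitive
          ≤⟨ +-mono-≤ (*-monoʳ-≤ (β ^ K) length-nonrepetitive) (*-monoʳ-≤ (β ^ K) length-repetitive) ⟩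
        β ^ K * #good S + β ^ K * sum (map (length ∘ newRealised) descriptors)
          ≤⟨ +-monoʳ-≤ (β ^ K * #good S) (*-sum-≤ (β ^ K) (κ ^ K * g₀) _ descriptors new-bound) ⟩
        β ^ K * #good S + length descriptors * (κ ^ K * g₀)
          ≤⟨ +-monoʳ-≤ (β ^ K * #good S) (*-monoˡ-≤ (κ ^ K * g₀) length-descriptors) ⟩
        β ^ K * #good S + 4 * k * (κ ^ K * g₀)
          ≡⟨ cong (β ^ K * #good S +_) (*-assoc (4 * k) (κ ^ K) g₀) ⟨
        β ^ K * #good S + 4 * k * κ ^ K * g₀
          ∎
        where
        open ≤-Reasoning
        nonrep? : ∀ p → Dec (¬ Repetition S (extend p))
        nonrep? p = ¬? (repetition? S (extend p))
        nonrepetitive repetitive : List Extension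
        nonrepetitive = filter nonrep? extensions
        repetitive = filter (¬? ∘ nonrep?) extensions
        newRealised : Descriptor → List Extension
        newRealised D = filter (newRepetition? D) extensions
        length-nonrepetitive : length nonrepetitive ≤ #good S
        length-nonrepetitive = length-≤-injection extend (Unique.filter⁺ nonrep? extensions-unique)
          (λ p∈ → let p∈′ , nonrep = ∈-filter⁻ nonrep? {xs = extensions} p∈
                   in ∈-good⁺ (extension-isListColouring p∈′) nonrep)
          (λ p∈ q∈ → extend-injective (proj₁ (∈-filter⁻ nonrep? {xs = extensions} p∈))
                                      (proj₁ (∈-filter⁻ nonrep? {xs = extensions} q∈)))
        length-repetitive : length repetitive ≤ sum (map (length ∘ newRealised) descriptors)
        length-repetitive = subst (length repetitive ≤_) (length-concatMap newRealised descriptors)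
          (length-≤-injection id (Unique.filter⁺ (¬? ∘ nonrep?) extensions-unique) into (λ _ _ eq → eq))
          where
          into : ∀ {p} → p ∈ repetitive → p ∈ concatMap newRealised descriptors
          into {p} p∈ with p∈′ , ¬nonrep ← ∈-filter⁻ (¬? ∘ nonrep?) {xs = extensions} p∈
            with D , D∈ , q ← repetition⇒newRepetition p∈′ (decidable-stable (repetition? S (extend p)) ¬nonrep) =
            ∈-concatMap⁺ newRealised (Any.map (λ { refl → ∈-filter⁺ (newRepetition? D) p∈′ q }) D∈)

    R≢0 : NonZero R
    R≢0 = m*n≢0⇒m≢0 R {{ℕ.>-nonZero (≤-trans (≤-trans (m^n>0 κ κ) (m≤n*m (κ ^ κ) (4 * k))) bound)}}

    β≢0 : NonZero β
    β≢0 = m*n≢0 R K {{R≢0}}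

    growth-step : ∀ S → GrowthBelow ∣ S ∣ → Growth S
    growth-step S ih v∈S = growth-arithmetic {β ^ K} {R} {K} {GrowthStep.g₀ S v∈S ih} {#good S} {4 * k * κ ^ K}
      {{m^n≢0 β K {{β≢0}}}} (GrowthStep.step-inequality S v∈S ih)
      (subst (_≤ R * β ^ K) (x∙yz≈y∙xz (4 * k) κ (κ ^ K)) bound)
      where open import Algebra.Properties.CommutativeSemigroup *-commutativeSemigroup using (x∙yz≈y∙xz)

    growth-below : ∀ N → GrowthBelow N
    growth-below (suc N) S (s≤s ∣S∣≤N) = growth-step S λ T ∣T∣<∣S∣ → growth-below N T (≤-trans ∣T∣<∣S∣ ∣S∣≤N)

    zero-colouring-good : replicate n 0 ∈ good (removeAll ⊤ id)
    zero-colouring-good = ∈-good⁺ colouring nonrepetitive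
      where
      empty : ∀ {t} → t ∉ₛ removeAll ⊤ id
      empty t∈ = proj₂ (∈-removeAll⁻ id t∈) _ refl
      colouring : IsListColouring lists (removeAll ⊤ id) (replicate n 0)
      colouring t = ⊥-elim ∘ empty , λ _ → Vec.lookup-replicate t 0
      nonrepetitive : ¬ Repetition (removeAll ⊤ id) (replicate n 0)
      nonrepetitive (i , j , i≢j , _ , d , u , w , o₁ , o₂ , M) =
        Fin.0≢1+n (ordering-injective o₁
          (meet-at-most-once i≢j (on-i F.zero) (on-j F.zero) (on-i (F.suc F.zero)) (on-j (F.suc F.zero))))
        where
        coincide : ∀ x → lookup u x ≡ oriented d (lookup w) x
        coincide x with M x
        ... | inj₁ eq           = eq
        ... | inj₂ (t∈ , _ , _) = ⊥-elim (empty t∈)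
        on-i : ∀ x → On i (lookup u x)
        on-i = ordering-on o₁
        on-j : ∀ x → On j (lookup u x)
        on-j x = subst (On j) (sym (coincide x)) (oriented-on d {P = On j} (ordering-on o₂) x)

    #good-⊤-positive : 0 < #good ⊤
    #good-⊤-positive = ℕ.>-nonZero⁻¹ (#good ⊤) {{m*n≢0⇒n≢0 (κ ^ n) {{ℕ.>-nonZero (<-≤-trans positive chain)}}}}
      where
      positive : 0 < β ^ n * #good (removeAll ⊤ id)
      positive = ℕ.>-nonZero⁻¹ _
        {{m*n≢0 (β ^ n) _ {{m^n≢0 β n {{β≢0}}}} {{ℕ.>-nonZero (∈⇒length>0 zero-colouring-good)}}}}
      chain : β ^ n * #good (removeAll ⊤ id) ≤ κ ^ n * #good ⊤
      chain = growth-removeAll (growth-below (suc ∣ ⊤ {n} ∣)) ⊤ ≤-refl id id (λ _ → ∈⊤)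

    nonrepetitive-colouring : ∃ λ c → IsListColouring lists ⊤ c × ¬ Repetition ⊤ c
    nonrepetitive-colouring with c , c∈ ← length>0⇒∈ #good-⊤-positive = c , ∈-good⁻ c∈

module FieldArithmetic (ℝ : RealField) where

  open Betweenness using (StrictlyBetween)
  open import Data.Nat as ℕ using (zero; suc)
  open import Data.Integer as ℤ using (ℤ; -[1+_])
  import Data.Integer.Properties as ℤ
  import Data.Nat.Properties as ℕ
  open import Data.Bool using (Bool; true; false; T)
  open import Data.Maybe using (nothing)
  open import Data.Product using (_×_; _,_)
  open import Data.Sum using (inj₁; inj₂)
  open import Data.Vec using (Vec)
  open import Data.Empty using (⊥-elim)
  open import Relation.Binary.PropositionalEquality
  open import Relation.Binary.Definitions using (DecidableEquality)
  open import Relation.Nullary using (¬_; Dec; yes; no)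
  open import Function using (_∘_)
  open import Algebra.Bundles using (CommutativeRing)
  open import Tactic.RingSolver.Core.AlmostCommutativeRing using (AlmostCommutativeRing; fromCommutativeRing)
  open import Tactic.RingSolver.Core.Expression using (Expr; Κ; Ι; _⊕_; _⊗_; _⊛_; ⊝_; module Eval)
  open import Tactic.RingSolver.Core.Polynomial.Parameters using (Homomorphism)
  open RealField ℝ using (Carrier; 0#; 1#; *-inv; <-tri; +-mono-<; *-pos)
    renaming (_<_ to _<ᵣ_)

  private module F = RealField ℝ

  commutativeRing : CommutativeRing _ _
  commutativeRing = record
    { isCommutativeRing = record
      { isRing = record
        { +-isAbelianGroup = record
          { isGroup = record
            { isMonoid = record
              { isSemigroup = record
                { isMagma = record { isEquivalence = isEquivalence ; ∙-cong = cong₂ F._+_ }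
                ; assoc = F.+-assoc }
              ; identity = F.+-idˡ , λ x → trans (F.+-comm x F.0#) (F.+-idˡ x) }
            ; inverse = F.+-invˡ , λ x → trans (F.+-comm x (F.- x)) (F.+-invˡ x)
            ; ⁻¹-cong = cong F.-_ }
          ; comm = F.+-comm }
        ; *-cong = cong₂ F._*_
        ; *-assoc = F.*-assoc
        ; *-identity = F.*-idˡ , λ x → trans (F.*-comm x F.1#) (F.*-idˡ x)
        ; distrib = F.distribˡ , λ x y z → trans (F.*-comm (y F.+ z) x)
                      (trans (F.distribˡ x y z) (cong₂ F._+_ (F.*-comm x y) (F.*-comm x z))) }
      ; *-comm = F.*-comm } }

  open CommutativeRing commutativeRing public
    using (_+_; _*_; -_; +-comm; +-assoc; +-identityˡ; +-identityʳ; -‿inverseʳ;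
           *-comm; *-assoc; *-identityˡ; zeroʳ; ring; +-abelianGroup; semiring)

  infixl 6 _−_
  _−_ : Carrier → Carrier → Carrier
  x − y = x + - y

  infix 4 _<_
  _<_ : Carrier → Carrier → Set
  _<_ = _<ᵣ_

  open import Algebra.Properties.Ring ring using (-‿distribˡ-*; -‿distribʳ-*)
  open import Algebra.Properties.AbelianGroup +-abelianGroup using (⁻¹-∙-comm; ε⁻¹≈ε; ⁻¹-involutive)
  open import Algebra.Properties.Semiring.Mult.TCOptimised semiring using (×-homo-+; ×1-homo-*; 1+×)
    renaming (_×_ to _×ᵣ_)

  -- The ring solver normalises polynomials with integer coefficients, interpreted through fromℤ.
  fromℤ : ℤ → Carrier
  fromℤ (ℤ.+ n)      = n ×ᵣ 1#
  fromℤ -[1+ n ]   = - (suc n ×ᵣ 1#)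

  private
    open ≡-Reasoning

    fromℤ-⊖ : ∀ m n → fromℤ (m ℤ.⊖ n) ≡ m ×ᵣ 1# − n ×ᵣ 1#
    fromℤ-⊖ m       zero    = sym (trans (cong ((m ×ᵣ 1#) +_) ε⁻¹≈ε) (+-identityʳ _))
    fromℤ-⊖ zero    (suc n) = sym (+-identityˡ _)
    fromℤ-⊖ (suc m) (suc n) = begin
      fromℤ (suc m ℤ.⊖ suc n)                 ≡⟨ cong fromℤ (ℤ.[1+m]⊖[1+n]≡m⊖n m n) ⟩
      fromℤ (m ℤ.⊖ n)                         ≡⟨ fromℤ-⊖ m n ⟩
      a − b                                   ≡⟨ +-identityˡ (a − b) ⟨
      0# + (a − b)                            ≡⟨ cong (_+ (a − b)) (-‿inverseʳ 1#) ⟨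
      (1# − 1#) + (a − b)                     ≡⟨ +-assoc 1# (- 1#) (a − b) ⟩
      1# + (- 1# + (a − b))                   ≡⟨ cong (1# +_) (+-assoc (- 1#) a (- b)) ⟨
      1# + ((- 1# + a) − b)                   ≡⟨ cong (λ w → 1# + (w − b)) (+-comm (- 1#) a) ⟩
      1# + ((a − 1#) − b)                     ≡⟨ cong (1# +_) (+-assoc a (- 1#) (- b)) ⟩
      1# + (a + (- 1# − b))                   ≡⟨ +-assoc 1# a _ ⟨
      (1# + a) + (- 1# − b)                   ≡⟨ cong ((1# + a) +_) (⁻¹-∙-comm 1# b) ⟩
      (1# + a) − (1# + b)                     ≡⟨ cong₂ _−_ (1+× m 1#) (1+× n 1#) ⟨
      suc m ×ᵣ 1# − suc n ×ᵣ 1#               ∎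
      where
      a b : Carrier
      a = m ×ᵣ 1#
      b = n ×ᵣ 1#

    fromℤ-neg+ : ∀ n → fromℤ (ℤ.- (ℤ.+ n)) ≡ - (n ×ᵣ 1#)
    fromℤ-neg+ zero    = sym ε⁻¹≈ε
    fromℤ-neg+ (suc n) = refl

    fromℤ-+ : ∀ i j → fromℤ (i ℤ.+ j) ≡ fromℤ i + fromℤ j
    fromℤ-+ (ℤ.+ m)      (ℤ.+ n)      = ×-homo-+ 1# m n
    fromℤ-+ (ℤ.+ m)      -[1+ n ]   = fromℤ-⊖ m (suc n)
    fromℤ-+ -[1+ m ]   (ℤ.+ n)      = trans (fromℤ-⊖ n (suc m)) (+-comm _ _)
    fromℤ-+ -[1+ m ]   -[1+ n ]   = begin
      - (suc (suc (m ℕ.+ n)) ×ᵣ 1#)            ≡⟨ cong (λ k → - (suc k ×ᵣ 1#)) (ℕ.+-suc m n) ⟨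
      - ((suc m ℕ.+ suc n) ×ᵣ 1#)              ≡⟨ cong -_ (×-homo-+ 1# (suc m) (suc n)) ⟩
      - (suc m ×ᵣ 1# + suc n ×ᵣ 1#)             ≡⟨ ⁻¹-∙-comm _ _ ⟨
      - (suc m ×ᵣ 1#) + - (suc n ×ᵣ 1#)         ∎

    fromℤ-* : ∀ i j → fromℤ (i ℤ.* j) ≡ fromℤ i * fromℤ j
    fromℤ-* (ℤ.+ m)      (ℤ.+ n)      = trans (cong fromℤ (ℤ.+◃n≡+n (m ℕ.* n))) (×1-homo-* m n)
    fromℤ-* (ℤ.+ m)      -[1+ n ]   = begin
      fromℤ (ℤ.+ m ℤ.* -[1+ n ])              ≡⟨ cong fromℤ (ℤ.-◃n≡-n (m ℕ.* suc n)) ⟩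
      fromℤ (ℤ.- (ℤ.+ (m ℕ.* suc n)))           ≡⟨ fromℤ-neg+ (m ℕ.* suc n) ⟩
      - ((m ℕ.* suc n) ×ᵣ 1#)                  ≡⟨ cong -_ (×1-homo-* m (suc n)) ⟩
      - (m ×ᵣ 1# * (suc n ×ᵣ 1#))               ≡⟨ -‿distribʳ-* _ _ ⟩
      m ×ᵣ 1# * - (suc n ×ᵣ 1#)                 ∎
    fromℤ-* -[1+ m ]   (ℤ.+ n)      = begin
      fromℤ (-[1+ m ] ℤ.* ℤ.+ n)              ≡⟨ cong fromℤ (ℤ.-◃n≡-n (suc m ℕ.* n)) ⟩
      fromℤ (ℤ.- (ℤ.+ (suc m ℕ.* n)))           ≡⟨ fromℤ-neg+ (suc m ℕ.* n) ⟩
      - ((suc m ℕ.* n) ×ᵣ 1#)                  ≡⟨ cong -_ (×1-homo-* (suc m) n) ⟩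
      - (suc m ×ᵣ 1# * (n ×ᵣ 1#))               ≡⟨ -‿distribˡ-* _ _ ⟩
      - (suc m ×ᵣ 1#) * (n ×ᵣ 1#)               ∎
    fromℤ-* -[1+ m ]   -[1+ n ]   = begin
      fromℤ (-[1+ m ] ℤ.* -[1+ n ])           ≡⟨ cong fromℤ (ℤ.+◃n≡+n (suc m ℕ.* suc n)) ⟩
      (suc m ℕ.* suc n) ×ᵣ 1#                  ≡⟨ ×1-homo-* (suc m) (suc n) ⟩
      a * b                                   ≡⟨ cong (_* b) (⁻¹-involutive a) ⟨
      - (- a) * b                             ≡⟨ -‿distribˡ-* (- a) b ⟨
      - (- a * b)                             ≡⟨ -‿distribʳ-* (- a) b ⟩
      - a * - b                               ∎
      where
      a b : Carrier
      a = suc m ×ᵣ 1#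
      b = suc n ×ᵣ 1#

    fromℤ-neg : ∀ i → fromℤ (ℤ.- i) ≡ - fromℤ i
    fromℤ-neg (ℤ.+ n)    = fromℤ-neg+ n
    fromℤ-neg -[1+ n ] = sym (⁻¹-involutive _)

    isZero : ℤ → Bool
    isZero (ℤ.+ zero) = true
    isZero _        = false

    isZero-sound : ∀ i → T (isZero i) → 0# ≡ fromℤ i
    isZero-sound (ℤ.+ zero) _ = refl

  almostCommutativeRing : AlmostCommutativeRing _ _
  almostCommutativeRing = fromCommutativeRing commutativeRing (λ _ → nothing)

  ℤ-homomorphism : Homomorphism _ _ _ _
  ℤ-homomorphism = record
    { from = record { rawRing = ℤ.+-*-rawRing ; isZero = isZero }
    ; to = almostCommutativeRing
    ; morphism = record
      { ⟦_⟧ = fromℤ ; +-homo = fromℤ-+ ; *-homo = fromℤ-* ; -‿homo = fromℤ-neg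
      ; 0-homo = refl ; 1-homo = refl }
    ; Zero-C⟶Zero-R = isZero-sound
    }

  module RingSolver where
    open Eval (AlmostCommutativeRing.rawRing almostCommutativeRing) fromℤ public
    open import Tactic.RingSolver.Core.Polynomial.Base (Homomorphism.from ℤ-homomorphism)
      renaming (ι to ιₚ)

    norm : ∀ {n} → Expr ℤ n → Poly n
    norm (Κ x)   = κ x
    norm (Ι x)   = ιₚ x
    norm (x ⊕ y) = norm x ⊞ norm y
    norm (x ⊗ y) = norm x ⊠ norm y
    norm (⊝ x)   = ⊟ norm x
    norm (x ⊛ i) = norm x ⊡ i

    ⟦_⇓⟧ : ∀ {n} → Expr ℤ n → Vec Carrier n → Carrier
    ⟦ e ⇓⟧ = ⟦ norm e ⟧ₚ
      where open import Tactic.RingSolver.Core.Polynomial.Semantics ℤ-homomorphism renaming (⟦_⟧ to ⟦_⟧ₚ)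

    correct : ∀ {n} (e : Expr ℤ n) ρ → ⟦ e ⇓⟧ ρ ≡ ⟦ e ⟧ ρ
    correct {n} = go
      where
      open import Tactic.RingSolver.Core.Polynomial.Homomorphism ℤ-homomorphism
      open import Algebra.Properties.Semiring.Exp.TCOptimised
        (AlmostCommutativeRing.semiring almostCommutativeRing) using (^-congˡ)
      go : ∀ (e : Expr ℤ n) ρ → ⟦ e ⇓⟧ ρ ≡ ⟦ e ⟧ ρ
      go (Κ x)   ρ = κ-hom x ρ
      go (Ι x)   ρ = ι-hom x ρ
      go (x ⊕ y) ρ = trans (⊞-hom (norm x) (norm y) ρ) (cong₂ _+_ (go x ρ) (go y ρ))
      go (x ⊗ y) ρ = trans (⊠-hom (norm x) (norm y) ρ) (cong₂ _*_ (go x ρ) (go y ρ))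
      go (⊝ x)   ρ = trans (⊟-hom (norm x) ρ) (cong -_ (go x ρ))
      go (x ⊛ i) ρ = trans (⊡-hom (norm x) i ρ) (^-congˡ i (go x ρ))

    open import Relation.Binary.Reflection (setoid Carrier) Ι ⟦_⟧ ⟦_⇓⟧ correct public using (solve)

    infix 4 _⊜_
    _⊜_ : ∀ {n} → Expr ℤ n → Expr ℤ n → Expr ℤ n × Expr ℤ n
    _⊜_ = _,_

  open RingSolver using (solve; _⊜_)

  open RingSolver using (solve; _⊜_)
  open import Algebra.Properties.AbelianGroup +-abelianGroup using (∙-cancelʳ; x∙y⁻¹≈ε⇒x≈y)

  infix 4 _≟_ _<?_
  <-irrefl : ∀ {x} → ¬ x < x
  <-irrefl {x} = F.<-irrefl x

  <-trans : ∀ {x y z} → x < y → y < z → x < z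
  <-trans {x} {y} {z} = F.<-trans x y z

  <⇒≢ : ∀ {x y} → x < y → x ≢ y
  <⇒≢ x<y refl = <-irrefl x<y

  _≟_ : DecidableEquality Carrier
  x ≟ y with <-tri x y
  ... | inj₁ x<y        = no (<⇒≢ x<y)
  ... | inj₂ (inj₁ x≡y) = yes x≡y
  ... | inj₂ (inj₂ y<x) = no (<⇒≢ y<x ∘ sym)

  <-asym : ∀ {x y} → x < y → ¬ y < x
  <-asym x<y y<x = <-irrefl (<-trans x<y y<x)

  _<?_ : (x y : Carrier) → Dec (x < y)
  x <? y with <-tri x y
  ... | inj₁ x<y        = yes x<y
  ... | inj₂ (inj₁ refl) = no <-irrefl
  ... | inj₂ (inj₂ y<x) = no (<-asym y<x)

  x*y≡0⇒y≡0 : ∀ {x y} → x ≢ 0# → x * y ≡ 0# → y ≡ 0#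
  x*y≡0⇒y≡0 {x} {y} x≢0 xy≡0 with x⁻¹ , xx⁻¹≡1 ← *-inv x x≢0 = begin
    y               ≡⟨ *-identityˡ y ⟨
    1# * y          ≡⟨ cong (_* y) (trans (sym xx⁻¹≡1) (*-comm x x⁻¹)) ⟩
    x⁻¹ * x * y     ≡⟨ *-assoc x⁻¹ x y ⟩
    x⁻¹ * (x * y)   ≡⟨ cong (x⁻¹ *_) xy≡0 ⟩
    x⁻¹ * 0#        ≡⟨ zeroʳ x⁻¹ ⟩
    0#              ∎
    where open ≡-Reasoning

  *-cancelˡ-≢0 : ∀ {x y z} → x ≢ 0# → x * y ≡ x * z → y ≡ z
  *-cancelˡ-≢0 {x} {y} {z} x≢0 xy≡xz = x∙y⁻¹≈ε⇒x≈y y z (x*y≡0⇒y≡0 x≢0 (begin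
    x * (y − z)       ≡⟨ solve 3 (λ x y z → x ⊗ (y ⊕ ⊝ z) ⊜ x ⊗ y ⊕ ⊝ (x ⊗ z)) refl x y z ⟩
    x * y − x * z     ≡⟨ cong (_− x * z) xy≡xz ⟩
    x * z − x * z     ≡⟨ -‿inverseʳ (x * z) ⟩
    0#                ∎))
    where open ≡-Reasoning

  +-cancelʳ : ∀ {x y} z → x + z ≡ y + z → x ≡ y
  +-cancelʳ {x} {y} z = ∙-cancelʳ z x y

  0<y−x⇒x<y : ∀ {x y} → 0# < y − x → x < y
  0<y−x⇒x<y {x} {y} 0<y−x = subst₂ _<_ (+-identityˡ x) (solve 2 (λ x y → (y ⊕ ⊝ x) ⊕ x ⊜ y) refl x y)
    (+-mono-< 0# (y − x) x 0<y−x)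

  x<y⇒0<y−x : ∀ {x y} → x < y → 0# < y − x
  x<y⇒0<y−x {x} {y} x<y = subst (_< y − x) (-‿inverseʳ x) (+-mono-< x y (- x) x<y)

  interpolation-between : ∀ {x z t} → 0# < t → t < 1# → x < z → x < x + t * (z − x) × x + t * (z − x) < z
  interpolation-between {x} {z} {t} 0<t t<1 x<z =
    0<y−x⇒x<y (subst (0# <_) above (*-pos t (z − x) 0<t (x<y⇒0<y−x x<z))) ,
    0<y−x⇒x<y (subst (0# <_) below (*-pos (1# − t) (z − x) (x<y⇒0<y−x t<1) (x<y⇒0<y−x x<z)))
    where
    above : t * (z − x) ≡ (x + t * (z − x)) − x
    above = solve 3 (λ x z t → t ⊗ (z ⊕ ⊝ x) ⊜ (x ⊕ t ⊗ (z ⊕ ⊝ x)) ⊕ ⊝ x) refl x z t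
    below : (1# − t) * (z − x) ≡ z − (x + t * (z − x))
    below = solve 3 (λ x z t → (Κ (ℤ.+ 1) ⊕ ⊝ t) ⊗ (z ⊕ ⊝ x) ⊜ z ⊕ ⊝ (x ⊕ t ⊗ (z ⊕ ⊝ x))) refl x z t

  interpolation-strictly-between : ∀ {x z t} → 0# < t → t < 1# → x ≢ z → StrictlyBetween _<_ x (x + t * (z − x)) z
  interpolation-strictly-between {x} {z} {t} 0<t t<1 x≢z with <-tri x z
  ... | inj₁ x<z        = inj₁ (interpolation-between 0<t t<1 x<z)
  ... | inj₂ (inj₁ x≡z) = ⊥-elim (x≢z x≡z)
  ... | inj₂ (inj₂ z<x) = inj₂ (subst (λ q → z < q × q < x) (sym flip)
                            (interpolation-between (x<y⇒0<y−x t<1) 1−t<1 z<x))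
    where
    1−t<1 : 1# − t < 1#
    1−t<1 = 0<y−x⇒x<y (subst (0# <_) (solve 1 (λ t → t ⊜ Κ (ℤ.+ 1) ⊕ ⊝ (Κ (ℤ.+ 1) ⊕ ⊝ t)) refl t) 0<t)
    flip : x + t * (z − x) ≡ z + (1# − t) * (x − z)
    flip = solve 3 (λ x z t → x ⊕ t ⊗ (z ⊕ ⊝ x) ⊜ z ⊕ (Κ (ℤ.+ 1) ⊕ ⊝ t) ⊗ (x ⊕ ⊝ z)) refl x z t

module PlaneGeometry (ℝ : RealField) where

  open Betweenness using (StrictlyBetween)
  open import Data.Product using (_×_; _,_)
  open import Data.Empty using (⊥-elim)
  open import Relation.Binary.PropositionalEquality
  open import Relation.Nullary using (¬_; Dec; yes; no)
  open import Function using (flip)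

  open Plane ℝ using (Point; Line; line; _on_; SameLine; Between)
  open FieldArithmetic ℝ
  open RealField ℝ using (Carrier; 0#)
  open RingSolver using (solve; _⊜_)
  open import Tactic.RingSolver.Core.Expression using (_⊕_; _⊗_; ⊝_)
  open import Algebra.Properties.AbelianGroup +-abelianGroup using (∙-cancelˡ; x∙y⁻¹≈ε⇒x≈y)

  _on?_ : ∀ p L → Dec (p on L)
  (x , y) on? line a b c _ = a * x + b * y + c ≟ 0#

  -- A line with b ≢ 0 is a graph over the x-axis, any other line over the y-axis.
  coordinate : Line → Point → Carrier
  coordinate (line a b c _) (x , y) with b ≟ 0#
  ... | yes _ = y
  ... | no _  = x

  coordinate-injective : ∀ L {p q} → p on L → q on L → coordinate L p ≡ coordinate L q → p ≡ q
  coordinate-injective (line a b c nondegenerate) {x₁ , y₁} {x₂ , y₂} p-on q-on eq with b ≟ 0#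
  ... | yes b≡0 = flip (cong₂ _,_) eq (*-cancelˡ-≢0 (λ a≡0 → nondegenerate (a≡0 , b≡0))
                    (+-cancelʳ (b * y₂) (+-cancelʳ c (trans (subst (λ y → a * x₁ + b * y + c ≡ 0#) eq p-on) (sym q-on)))))
  ... | no b≢0  = cong₂ _,_ eq (*-cancelˡ-≢0 b≢0
                    (∙-cancelˡ (a * x₂) _ _ (+-cancelʳ c (trans (subst (λ x → a * x + b * y₁ + c ≡ 0#) eq p-on) (sym q-on)))))

  between-coordinate : ∀ L {p q r} → Between p q r → coordinate L p ≢ coordinate L r →
    StrictlyBetween _<_ (coordinate L p) (coordinate L q) (coordinate L r)
  between-coordinate (line a b c _) {px , py} {qx , qy} {rx , ry} (t , 0<t , t<1 , qx≡ , qy≡) p≢r with b ≟ 0#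
  ... | yes _ = subst (λ q → StrictlyBetween _<_ py q ry) (sym qy≡) (interpolation-strictly-between 0<t t<1 p≢r)
  ... | no _  = subst (λ q → StrictlyBetween _<_ px q rx) (sym qx≡) (interpolation-strictly-between 0<t t<1 p≢r)

  nonzero-vector-annihilates : ∀ {u v w} → ¬ (u ≡ 0# × v ≡ 0#) → u * w ≡ 0# → v * w ≡ 0# → w ≡ 0#
  nonzero-vector-annihilates {u} {v} nonzero uw≡0 vw≡0 with u ≟ 0# | v ≟ 0#
  ... | no u≢0  | _       = x*y≡0⇒y≡0 u≢0 uw≡0
  ... | yes _   | no v≢0  = x*y≡0⇒y≡0 v≢0 vw≡0
  ... | yes u≡0 | yes v≡0 = ⊥-elim (nonzero (u≡0 , v≡0))

  combination-of-zeros : ∀ {X α β E F} → X ≡ α * E + β * F → E ≡ 0# → F ≡ 0# → X ≡ 0#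
  combination-of-zeros {α = α} {β} X≡ refl refl = trans X≡ (trans (cong₂ _+_ (zeroʳ α) (zeroʳ β)) (+-identityˡ 0#))

  direction-on-line : ∀ {a b c px py rx ry} → a * px + b * py + c ≡ 0# → a * rx + b * ry + c ≡ 0# →
    a * (rx − px) + b * (ry − py) ≡ 0#
  direction-on-line {a} {b} {c} {px} {py} {rx} {ry} p-on r-on = begin
    a * (rx − px) + b * (ry − py)                     ≡⟨ solve 7 (λ a b c px py rx ry →
                                                           a ⊗ (rx ⊕ ⊝ px) ⊕ b ⊗ (ry ⊕ ⊝ py) ⊜
                                                           (a ⊗ rx ⊕ b ⊗ ry ⊕ c) ⊕ ⊝ (a ⊗ px ⊕ b ⊗ py ⊕ c))
                                                         refl a b c px py rx ry ⟩
    (a * rx + b * ry + c) − (a * px + b * py + c)     ≡⟨ cong₂ _−_ r-on p-on ⟩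
    0# − 0#                                           ≡⟨ -‿inverseʳ 0# ⟩
    0#                                                ∎
    where open ≡-Reasoning

  normal-to-both⇒parallel : ∀ {a b ux uy dx dy} → ¬ (a ≡ 0# × b ≡ 0#) →
    a * ux + b * uy ≡ 0# → a * dx + b * dy ≡ 0# → ux * dy − uy * dx ≡ 0#
  normal-to-both⇒parallel {a} {b} {ux} {uy} {dx} {dy} nonzero u⊥ d⊥ = nonzero-vector-annihilates nonzero
    (combination-of-zeros
      (solve 6 (λ a b ux uy dx dy →
         a ⊗ (ux ⊗ dy ⊕ ⊝ (uy ⊗ dx)) ⊜ dy ⊗ (a ⊗ ux ⊕ b ⊗ uy) ⊕ (⊝ uy) ⊗ (a ⊗ dx ⊕ b ⊗ dy))
       refl a b ux uy dx dy)
      u⊥ d⊥)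
    (combination-of-zeros
      (solve 6 (λ a b ux uy dx dy →
         b ⊗ (ux ⊗ dy ⊕ ⊝ (uy ⊗ dx)) ⊜ ux ⊗ (a ⊗ dx ⊕ b ⊗ dy) ⊕ (⊝ dx) ⊗ (a ⊗ ux ⊕ b ⊗ uy))
       refl a b ux uy dx dy)
      d⊥ u⊥)

  parallel⇒normal : ∀ {a b ux uy dx dy} → ¬ (dx ≡ 0# × dy ≡ 0#) →
    ux * dy − uy * dx ≡ 0# → a * dx + b * dy ≡ 0# → a * ux + b * uy ≡ 0#
  parallel⇒normal {a} {b} {ux} {uy} {dx} {dy} nonzero u∥d d⊥ = nonzero-vector-annihilates nonzero
    (combination-of-zeros
      (solve 6 (λ a b ux uy dx dy →
         dx ⊗ (a ⊗ ux ⊕ b ⊗ uy) ⊜ ux ⊗ (a ⊗ dx ⊕ b ⊗ dy) ⊕ (⊝ b) ⊗ (ux ⊗ dy ⊕ ⊝ (uy ⊗ dx)))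
       refl a b ux uy dx dy)
      d⊥ u∥d)
    (combination-of-zeros
      (solve 6 (λ a b ux uy dx dy →
         dy ⊗ (a ⊗ ux ⊕ b ⊗ uy) ⊜ uy ⊗ (a ⊗ dx ⊕ b ⊗ dy) ⊕ a ⊗ (ux ⊗ dy ⊕ ⊝ (uy ⊗ dx)))
       refl a b ux uy dx dy)
      d⊥ u∥d)

  on-both-lines : ∀ {L M p q} → p ≢ q → p on L → q on L → p on M → q on M → ∀ {r} → r on L → r on M
  on-both-lines {line a b c L-nondegenerate} {line a′ b′ c′ _} {px , py} {qx , qy}
                p≢q p-on-L q-on-L p-on-M q-on-M {rx , ry} r-on-L = begin
    a′ * rx + b′ * ry + c′                                 ≡⟨ shift ⟩
    (a′ * (rx − px) + b′ * (ry − py)) + (a′ * px + b′ * py + c′)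
                                                           ≡⟨ cong₂ _+_ r−p-on-M p-on-M ⟩
    0# + 0#                                                ≡⟨ +-identityˡ 0# ⟩
    0#                                                     ∎
    where
    open ≡-Reasoning
    shift : a′ * rx + b′ * ry + c′ ≡ (a′ * (rx − px) + b′ * (ry − py)) + (a′ * px + b′ * py + c′)
    shift = solve 7 (λ a b c px py rx ry →
      a ⊗ rx ⊕ b ⊗ ry ⊕ c ⊜ (a ⊗ (rx ⊕ ⊝ px) ⊕ b ⊗ (ry ⊕ ⊝ py)) ⊕ (a ⊗ px ⊕ b ⊗ py ⊕ c)) refl a′ b′ c′ px py rx ry
    q≢p : ¬ (qx − px ≡ 0# × qy − py ≡ 0#)
    q≢p (dx≡0 , dy≡0) = p≢q (sym (cong₂ _,_ (x∙y⁻¹≈ε⇒x≈y qx px dx≡0) (x∙y⁻¹≈ε⇒x≈y qy py dy≡0)))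
    r−p-on-M : a′ * (rx − px) + b′ * (ry − py) ≡ 0#
    r−p-on-M = parallel⇒normal q≢p
      (normal-to-both⇒parallel L-nondegenerate (direction-on-line p-on-L r-on-L) (direction-on-line p-on-L q-on-L))
      (direction-on-line p-on-M q-on-M)

  two-common-points⇒SameLine : ∀ {L M p q} → p ≢ q → p on L → q on L → p on M → q on M → SameLine L M
  two-common-points⇒SameLine {L} {M} p≢q p-on-L q-on-L p-on-M q-on-M r =
    on-both-lines {L} {M} p≢q p-on-L q-on-L p-on-M q-on-M , on-both-lines {M} {L} p≢q p-on-M q-on-M p-on-L q-on-L

module GeometricLines (ℝ : RealField) {m n K : ℕ} (L : Fin m → Plane.Line ℝ) (P : Fin n → Plane.Point ℝ)
  (distinct-lines : Plane.DistinctLines ℝ L) (general-position : Plane.GeneralPosition ℝ L)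
  (distinct-points : Plane.DistinctPoints ℝ P) (k-points : ∀ i → Plane.ContainsExactly ℝ P (L i) (suc (suc K))) where

  open Betweenness
  open FinLemmas
  open RosenfeldCounting
  open import Data.Nat using (suc)
  open import Data.Fin as F using ()
  import Data.Fin.Properties as Fin
  import Data.Fin.Induction as Fin
  open import Data.Product using (_,_; proj₁; proj₂)
  open import Data.Sum using (_⊎_; inj₁; inj₂)
  open import Data.Empty using (⊥-elim)
  open import Data.Bool using (true; false)
  open import Data.Vec using (tabulate)
  import Data.Vec.Properties as Vec
  open import Relation.Binary.PropositionalEquality using (refl; sym; trans; cong; subst; subst₂)
  open import Relation.Binary.Definitions using (tri<; tri≈; tri>)
  open import Relation.Nullary using (Dec; yes; no)
  open import Relation.Nullary.Decidable using (_×-dec_; _→-dec_)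
  open import Induction.WellFounded using (module All)
  open import Level using (0ℓ)
  open import Function using (_∘_)
  open Plane ℝ using (_on_; AlongLine)
  open FieldArithmetic ℝ
  open PlaneGeometry ℝ

  On : Fin m → Fin n → Set
  On i t = P t on L i

  position : Fin m → Fin n → RealField.Carrier ℝ
  position i t = coordinate (L i) (P t)

  position-injective : ∀ {i s t} → On i s → On i t → position i s ≡ position i t → s ≡ t
  position-injective {i} s-on t-on = distinct-points _ _ ∘ coordinate-injective (L i) s-on t-on

  k : ℕ
  k = suc (suc K)

  Ordering : Fin m → (Fin k → Fin n) → Set
  Ordering i f = (∀ a → On i (f a)) × (∀ t → On i t → ∃ λ a → f a ≡ t) ×
                 (∀ a b → a F.< b → position i (f a) < position i (f b))

  ordering? : ∀ i f → Dec (Ordering i f)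
  ordering? i f = Fin.all? (λ a → P (f a) on? L i) ×-dec
                  Fin.all? (λ t → (P t on? L i) →-dec Fin.any? (λ a → f a Fin.≟ t)) ×-dec
                  Fin.all? (λ a → Fin.all? λ b → (a Fin.<? b) →-dec (position i (f a) <? position i (f b)))

  ordering-injective : ∀ {i f} → Ordering i f → ∀ {a b} → f a ≡ f b → a ≡ b
  ordering-injective {i} (_ , _ , increasing) {a} {b} fa≡fb with Fin.<-cmp a b
  ... | tri< a<b _ _ = ⊥-elim (<⇒≢ (increasing a b a<b) (cong (position i) fa≡fb))
  ... | tri≈ _ a≡b _ = a≡b
  ... | tri> _ _ b<a = ⊥-elim (<⇒≢ (increasing b a b<a) (cong (position i) (sym fa≡fb)))

  ordering-unique : ∀ {i f g} → Ordering i f → Ordering i g → ∀ a → f a ≡ g a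
  ordering-unique {i} {f} {g} o₁@(f-on , f-onto , f-incr) o₂@(g-on , g-onto , g-incr) =
    All.wfRec Fin.<-wellFounded 0ℓ (λ a → f a ≡ g a) step
    where
    step : ∀ a → (∀ {b} → b F.< a → f b ≡ g b) → f a ≡ g a
    step a below with f-onto (g a) (g-on a) | g-onto (f a) (f-on a)
    ... | b , fb≡ga | b′ , gb′≡fa with Fin.<-cmp b a | Fin.<-cmp b′ a
    ... | tri< b<a _ _ | _ = ⊥-elim (Fin.<-irrefl (ordering-injective o₂ (trans (sym (below b<a)) fb≡ga)) b<a)
    ... | tri≈ _ refl _ | _ = fb≡ga
    ... | _ | tri< b′<a _ _ = ⊥-elim (Fin.<-irrefl (ordering-injective o₁ (trans (below b′<a) gb′≡fa)) b′<a)
    ... | _ | tri≈ _ refl _ = sym gb′≡fa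
    ... | tri> _ _ a<b | tri> _ _ a<b′ = ⊥-elim (<-asym
      (subst (position i (f a) <_) (cong (position i) fb≡ga) (f-incr a b a<b))
      (subst (position i (g a) <_) (cong (position i) gb′≡fa) (g-incr a b′ a<b′)))

  meet-at-most-once : ∀ {i j s t} → i ≢ j → On i s → On j s → On i t → On j t → s ≡ t
  meet-at-most-once {i} {j} {s} {t} i≢j s-on-i s-on-j t-on-i t-on-j with s Fin.≟ t
  ... | yes s≡t = s≡t
  ... | no s≢t  = ⊥-elim (distinct-lines i j i≢j
    (two-common-points⇒SameLine {L i} {L j} (s≢t ∘ distinct-points s t) s-on-i t-on-i s-on-j t-on-j))

  lineSystem : OrderedLineSystem n m k
  lineSystem = record
    { On                  = On
    ; on?                 = λ i t → P t on? L i
    ; Ordering            = Ordering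
    ; ordering?           = ordering?
    ; ordering-unique     = ordering-unique
    ; ordering-injective  = ordering-injective
    ; ordering-on         = proj₁
    ; ordering-onto       = λ o {t} → proj₁ (proj₂ o) t
    ; meet-at-most-once   = meet-at-most-once
    ; no-three-concurrent = λ i≢j j≢l i≢l → general-position _ _ _ i≢j j≢l i≢l _
    ; at-most-k-points    = λ i → proj₁ (k-points i) , λ {t} → proj₂ (proj₂ (proj₂ (k-points i))) t
    }

  module _ {i : Fin m} {e : Fin k → Fin n} (along : AlongLine P (L i) e) where

    private
      h : Fin k → RealField.Carrier ℝ
      h a = position i (e a)

      e-injective : ∀ a b → e a ≡ e b → a ≡ b
      e-injective = proj₁ along

      e-on : ∀ a → On i (e a)
      e-on = proj₁ (proj₂ along)

      e-onto : ∀ t → On i t → ∃ λ a → e a ≡ t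
      e-onto = proj₁ (proj₂ (proj₂ along))

      between : ∀ {a b c} → a F.< b → b F.< c → StrictlyBetween _<_ (h a) (h b) (h c)
      between {a} {b} {c} a<b b<c = between-coordinate (L i) (proj₂ (proj₂ (proj₂ along)) a b c a<b b<c)
        λ ha≡hc → Fin.<-irrefl (e-injective a c (position-injective (e-on a) (e-on c) ha≡hc)) (Fin.<-trans a<b b<c)

      reversed-onto : ∀ t → On i t → ∃ λ a → e (F.opposite a) ≡ t
      reversed-onto t t-on with a , ea≡t ← e-onto t t-on = F.opposite a , trans (cong e (Fin.opposite-involutive a)) ea≡t

    along⇒ordering : Ordering i e ⊎ Ordering i (e ∘ F.opposite)
    along⇒ordering with RealField.<-tri ℝ (h F.zero) (h (F.fromℕ (suc K)))
    ... | inj₁ h₀<hₗ       =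
          inj₁ (e-on , e-onto , λ a b → between⇒monotone {_≺_ = _<_} <-irrefl <-trans h between h₀<hₗ)
    ... | inj₂ (inj₁ h₀≡hₗ) = ⊥-elim (Fin.0≢1+n (e-injective _ _ (position-injective (e-on _) (e-on _) h₀≡hₗ)))
    ... | inj₂ (inj₂ hₗ<h₀) = inj₂ (e-on ∘ F.opposite , reversed-onto , λ a b a<b →
          between⇒monotone {_≺_ = λ x y → y < x} <-irrefl (λ y<x z<y → <-trans z<y y<x) h
            (λ a<b b<c → StrictlyBetween-flip {_≺_ = _<_} (between a<b b<c)) hₗ<h₀ (opposite-reverses-< a<b))

  ordering-cong : ∀ {i f g} → (∀ a → f a ≡ g a) → Ordering i f → Ordering i g
  ordering-cong {i} f≗g (on , onto , increasing) =
    (λ a → subst (On i) (f≗g a) (on a)) ,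
    (λ t t-on → let a , fa≡t = onto t t-on in a , trans (sym (f≗g a)) fa≡t) ,
    λ a b a<b → subst₂ _<_ (cong (position i) (f≗g a)) (cong (position i) (f≗g b)) (increasing a b a<b)

  open Repetitions lineSystem

  orderings⇒repetition : ∀ {S c i j f g} d → i ≢ j → Meet i j → Ordering i f → Ordering j g →
    Matching S c f (oriented d g) → Repetition S c
  orderings⇒repetition {S} {c} {i} {j} {f} {g} d i≢j meet o₁ o₂ M =
    i , j , i≢j , meet , d , tabulate f , tabulate g ,
    ordering-cong (sym ∘ Vec.lookup∘tabulate f) o₁ , ordering-cong (sym ∘ Vec.lookup∘tabulate g) o₂ ,
    λ x → subst₂ (Agree S c) (sym (Vec.lookup∘tabulate f x)) (sym (oriented-cong d (Vec.lookup∘tabulate g) x)) (M x)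

  along⇒repetition : ∀ {S c i j e₁ e₂} → i ≢ j → Meet i j → AlongLine P (L i) e₁ → AlongLine P (L j) e₂ →
    Matching S c e₁ e₂ → Repetition S c
  along⇒repetition {S} {c} {e₂ = e₂} i≢j meet along₁ along₂ M with along⇒ordering along₁ | along⇒ordering along₂
  ... | inj₁ o₁ | inj₁ o₂ = orderings⇒repetition {S} {c} true  i≢j meet o₁ o₂ M
  ... | inj₁ o₁ | inj₂ o₂ = orderings⇒repetition {S} {c} false i≢j meet o₁ o₂
                              λ x → subst (Agree S c _) (cong e₂ (sym (Fin.opposite-involutive x))) (M x)
  ... | inj₂ o₁ | inj₁ o₂ = orderings⇒repetition {S} {c} false i≢j meet o₁ o₂ (M ∘ F.opposite)
  ... | inj₂ o₁ | inj₂ o₂ = orderings⇒repetition {S} {c} true  i≢j meet o₁ o₂ (M ∘ F.opposite)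


open RosenfeldCounting using (module Nonrepetitive)
open NatArithmetic using (bound-conversion)

corollary4p8 : (ℝ : RealField) → let open Plane ℝ in
    (k R m n : ℕ) → 3 ≤ k → BoundHolds k R →
    (L : Fin m → Line) → DistinctLines L → GeneralPosition L →
    (P : Fin n → Point) → DistinctPoints P →
    (∀ i → ContainsExactly P (L i) k) →
    (lists : Fin n → List ℕ) → (∀ t → Unique (lists t)) →
    (∀ t → R ≤ length (lists t)) →
    ∃ λ (col : Fin n → ℕ) → (∀ t → col t ∈ lists t) ×
    (∀ (i j : Fin m) → i ≢ j → (∃ λ t → (P t on L i) × (P t on L j)) →
    ∀ (e₁ e₂ : Fin k → Fin n) → AlongLine P (L i) e₁ → AlongLine P (L j) e₂ →
    ¬ (∀ a → col (e₁ a) ≡ col (e₂ a)))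
corollary4p8 ℝ (suc (suc (suc K′))) R m n (s≤s (s≤s (s≤s z≤n))) bound L distinct-lines general-position
             P distinct-points k-points lists lists-unique R≤∣lists∣ =
  let c , list-colouring , nonrepetitive =
        Nonrepetitive.nonrepetitive-colouring lineSystem lists lists-unique R R≤∣lists∣ (bound-conversion K′ R bound)
  in lookup c , (λ t → proj₁ (list-colouring t) ∈⊤) ,
     λ i j i≢j meet e₁ e₂ along₁ along₂ same-colours →
       nonrepetitive (along⇒repetition {c = c} i≢j meet along₁ along₂ λ a → inj₂ (∈⊤ , ∈⊤ , same-colours a))
  where open GeometricLines ℝ L P distinct-lines general-position distinct-points k-points
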